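{- Let $S=\{s_1<\dots<s_p\}$ be a nonempty pinnacle set with $s_p=n$. Let $t$ be the largest integer smaller than $n$ that does not belong to $S$, and let $T=\{s\in S \mid s<t\}$, so that $S=T\cup[t+1,n]$. Then \[ p_n(S)= p_n\big(T\cup\{t\}\cup[t+2,n]\big) + 2\,p_{n-1}\big(T\cup[t,n-1]\big) + 2(n-t)\,p_{n-2}\big(T\cup[t,n-2]\big). \]
   Context: For a permutation $\sigma=\sigma_1\cdots\sigma_m$ of $[m]=\{1,\dots,m\}$ (one-line notation), its pinnacle set is $\mathrm{Pin}\,\sigma=\{\sigma_i \mid 1<i<m,\ \sigma_{i-1}<\sigma_i>\sigma_{i+1}\}$. A pinnacle set is a finite set $S$ of positive integers such that $S=\mathrm{Pin}\,\sigma$ for some permutation $\sigma$; equivalently $S=\{s_1<\dots<s_p\}$ with $s_i>2i$ for all $i$. For any finite set $S$ of positive integers and any integer $m\ge 0$, $p_m(S)$ denotes the number of permutations $\sigma$ of $[m]$ with $\mathrm{Pin}\,\sigma=S$ (so $p_m(S)=0$ if $S$ is not a pinnacle set). For integers $a,b$, $[a,b]=\{a,a+1,\dots,b\}$, which is empty if $a>b$. -}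

module Defs where

open import Data.Nat using (ℕ; zero; suc; _+_; _∸_; _<ᵇ_)
open import Data.Nat.Properties using (_≟_)
open import Data.Bool using (Bool; true; false; _∧_; if_then_else_)
open import Data.List using (List; []; _∷_; _++_; map; concatMap; upTo; length; filter)
open import Data.Bool.ListAction using (and)
open import Data.List.Membership.Propositional using (_∈_)
open import Data.List.Membership.DecPropositional _≟_ using (_∈?_)
open import Data.List.Relation.Binary.Permutation.Propositional using (_↭_)
open import Data.Product using (∃-syntax; _×_)
open import Function.Bundles using (_⇔_)
open import Relation.Nullary.Decidable using (⌊_⌋)

-- Finite sets of positive integers are represented by lists (order and
-- multiplicity irrelevant); equality of such sets is equality of membership.

-- [a,b] = {a, a+1, ..., b}, empty if a > b
range : ℕ → ℕ → List ℕ
range a b = map (a +_) (upTo (suc b ∸ a))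

[_] : ℕ → List ℕ
[ m ] = range 1 m

Pin : List ℕ → List ℕ
Pin (a ∷ b ∷ c ∷ rest) =
  if (a <ᵇ b) ∧ (c <ᵇ b) then b ∷ Pin (b ∷ c ∷ rest) else Pin (b ∷ c ∷ rest)
Pin _ = []

SameSet : List ℕ → List ℕ → Set
SameSet A B = ∀ x → (x ∈ A) ⇔ (x ∈ B)

subsetᵇ : List ℕ → List ℕ → Bool
subsetᵇ A B = and (map (λ x → ⌊ x ∈? B ⌋) A)

sameSetᵇ : List ℕ → List ℕ → Bool
sameSetᵇ A B = subsetᵇ A B ∧ subsetᵇ B A

-- a permutation of [m] in one-line notation
IsPerm : ℕ → List ℕ → Set
IsPerm m σ = σ ↭ [ m ]

IsPinnacleSet : List ℕ → Set
IsPinnacleSet S = ∃[ m ] ∃[ σ ] (IsPerm m σ × SameSet (Pin σ) S)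

insertions : ℕ → List ℕ → List (List ℕ)
insertions x [] = (x ∷ []) ∷ []
insertions x (y ∷ ys) = (x ∷ y ∷ ys) ∷ map (y ∷_) (insertions x ys)

perms : ℕ → List (List ℕ)
perms zero = [] ∷ []
perms (suc m) = concatMap (insertions (suc m)) (perms m)

p : ℕ → List ℕ → ℕ
p m S = length (filter (λ σ → sameSetᵇ (Pin σ) S Data.Bool.≟ true) (perms m))

{-# OPTIONS --safe #-}
module Submission where

-- Write S = T ∪ [t+1,n] with t ∉ S, and count permutations σ of [n] with pinnacle set S
-- according to the relative position of the values t and t+1.
--  * If they are not adjacent, exchanging them preserves all other comparisons between
--    neighbours; since t+1 ∈ S and t ∉ S, this is a bijection onto the permutations with
--    pinnacle set T ∪ {t} ∪ [t+2,n].
--  * If they are adjacent, reversal exchanges the patterns "t, t+1" and "t+1, t", so it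
--    suffices to count the pattern "t, t+1" twice.  Then t+1 is followed by some b < t,
--    and we split on the letter a in front of t:
--      - no such letter: delete t, t+1 and relabel; this gives the permutations of
--        [n-2] with pinnacle set T ∪ [t, n-2];
--      - a < t: delete t and relabel; this gives the permutations of [n-1] with pinnacle
--        set T ∪ [t, n-1];
--      - a ≥ t+2: then a is a pinnacle; deleting t, t+1 and relabelling gives again a
--        permutation of [n-2] with pinnacle set T ∪ [t, n-2], in which a-2 is a pinnacle,
--        and conversely t, t+1 can be inserted after any of its n-t-1 pinnacles ≥ t.
--    Altogether the pattern "t, t+1" occurs in p_{n-1}(…) + (n-t) p_{n-2}(…) permutations.

open import Defs
open import Data.Nat using (ℕ; zero; suc; _+_; _*_; _∸_; _<_; _≤_; _<ᵇ_; _≡ᵇ_; z≤n; s≤s)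
open import Data.Nat.Properties
open import Data.Nat.Tactic.RingSolver using (solve-∀)
open import Data.Bool using (Bool; true; false; _∧_; _∨_; not; if_then_else_) renaming (T to IsTrue)
import Data.Bool
open import Data.Bool.Properties using (∧-identityʳ; ∧-zeroʳ)
open import Data.List using (List; []; _∷_; _++_; map; concatMap; upTo; length; filter; reverse; InitLast; initLast; _∷ʳ′_)
import Data.List.Properties as List
open import Data.List.Properties using (∷-injective; ++-assoc; ∷ʳ-injective)
open import Data.List.Membership.Propositional using (_∈_; _∉_; find; lose)
open import Data.List.Membership.DecPropositional _≟_ using (_∈?_)
open import Data.List.Membership.Propositional.Properties
  using (∈-++⁺ˡ; ∈-++⁺ʳ; ∈-++⁻; ∈-map⁺; ∈-map⁻; ∈-∃++; ∈-upTo⁺; ∈-upTo⁻; ∈-concatMap⁺; ∈-concatMap⁻)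
open import Data.List.Relation.Unary.Any using (here; there)
import Data.List.Relation.Unary.Any.Properties as Any
open import Data.List.Relation.Unary.All using (All; []; _∷_)
import Data.List.Relation.Unary.All as All
open import Data.List.Relation.Unary.Unique.Propositional using (Unique)
open import Data.List.Relation.Unary.AllPairs using ([]; _∷_)
import Data.List.Relation.Unary.Unique.Propositional.Properties as Unique
import Data.List.Relation.Binary.Permutation.Propositional as Perm
open import Data.Product using (∃; ∃₂; _×_; _,_; proj₁; proj₂)
open import Data.Sum using (_⊎_; inj₁; inj₂; [_,_]′; map₁)
open import Data.Empty using (⊥; ⊥-elim)
open import Data.Unit using (⊤; tt)
open import Function.Base using (_∘_)
open import Function.Bundles using (_⇔_; mk⇔; module Equivalence)
open import Relation.Nullary using (¬_; yes; no)
open import Relation.Binary.Definitions using (tri<; tri≈; tri>)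
open import Relation.Binary.PropositionalEquality hiding ([_])

open Equivalence using (to; from)

true≢false : true ≢ false
true≢false ()

∧-trueˡ : ∀ {a b} → (a ∧ b) ≡ true → a ≡ true
∧-trueˡ {true} _ = refl

∧-trueʳ : ∀ {a b} → (a ∧ b) ≡ true → b ≡ true
∧-trueʳ {true} e = e

∧-true⁺ : ∀ {a b} → a ≡ true → b ≡ true → (a ∧ b) ≡ true
∧-true⁺ refl refl = refl

∨-falseˡ : ∀ {a b} → (a ∨ b) ≡ false → a ≡ false
∨-falseˡ {false} _ = refl

∨-falseʳ : ∀ {a b} → (a ∨ b) ≡ false → b ≡ false
∨-falseʳ {false} e = e

∨-trueʳ : ∀ a → (a ∨ true) ≡ true
∨-trueʳ true = refl
∨-trueʳ false = refl

not-true⁻ : ∀ {a} → not a ≡ true → a ≡ false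
not-true⁻ {false} _ = refl

not-true⁺ : ∀ {a} → a ≡ false → not a ≡ true
not-true⁺ refl = refl

≡ᵇ-true⇒≡ : ∀ {x y} → (x ≡ᵇ y) ≡ true → x ≡ y
≡ᵇ-true⇒≡ {x} {y} e = ≡ᵇ⇒≡ x y (subst IsTrue (sym e) tt)

≡ᵇ-refl : ∀ x → (x ≡ᵇ x) ≡ true
≡ᵇ-refl zero = refl
≡ᵇ-refl (suc x) = ≡ᵇ-refl x

≡ᵇ-false⇒≢ : ∀ {x y} → (x ≡ᵇ y) ≡ false → x ≢ y
≡ᵇ-false⇒≢ {x} e refl with trans (sym (≡ᵇ-refl x)) e
... | ()

≢⇒≡ᵇ-false : ∀ {x y} → x ≢ y → (x ≡ᵇ y) ≡ false
≢⇒≡ᵇ-false {x} {y} ne with x ≡ᵇ y in e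
... | true = ⊥-elim (ne (≡ᵇ-true⇒≡ e))
... | false = refl

<ᵇ-true⇒< : ∀ {a b} → (a <ᵇ b) ≡ true → a < b
<ᵇ-true⇒< {a} {b} e = <ᵇ⇒< a b (subst IsTrue (sym e) tt)

<⇒<ᵇ-true : ∀ {a b} → a < b → (a <ᵇ b) ≡ true
<⇒<ᵇ-true {a} {b} h with a <ᵇ b | <⇒<ᵇ h
... | true | _ = refl

≮⇒<ᵇ-false : ∀ {a b} → ¬ (a < b) → (a <ᵇ b) ≡ false
≮⇒<ᵇ-false {a} {b} h with a <ᵇ b in e
... | true = ⊥-elim (h (<ᵇ-true⇒< e))
... | false = refl

module _ {A : Set} where

  Distinct : List A → Set
  Distinct [] = ⊤
  Distinct (x ∷ xs) = (x ∉ xs) × Distinct xs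

  count : (A → Bool) → List A → ℕ
  count P [] = 0
  count P (x ∷ xs) = if P x then suc (count P xs) else count P xs

  private
    ∈-weaken : ∀ {z y} (ys₁ : List A) {ys₂} → z ∈ ys₁ ++ ys₂ → z ∈ ys₁ ++ y ∷ ys₂
    ∈-weaken [] p = there p
    ∈-weaken (w ∷ ys₁) (here e) = here e
    ∈-weaken (w ∷ ys₁) (there p) = there (∈-weaken ys₁ p)

    ∈-remove : ∀ {z y} (ys₁ : List A) {ys₂} → z ∈ ys₁ ++ y ∷ ys₂ → z ≢ y → z ∈ ys₁ ++ ys₂
    ∈-remove [] (here e) ne = ⊥-elim (ne e)
    ∈-remove [] (there p) ne = p
    ∈-remove (w ∷ ys₁) (here e) ne = here e
    ∈-remove (w ∷ ys₁) (there p) ne = there (∈-remove ys₁ p ne)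

    Distinct-remove : ∀ {y} (ys₁ : List A) {ys₂} → Distinct (ys₁ ++ y ∷ ys₂) → Distinct (ys₁ ++ ys₂)
    Distinct-remove [] (_ , nd) = nd
    Distinct-remove (w ∷ ys₁) (w∉ , nd) = (λ p → w∉ (∈-weaken ys₁ p)) , Distinct-remove ys₁ nd

    count-remove : ∀ (Q : A → Bool) {y} (ys₁ : List A) {ys₂} → Q y ≡ true →
      count Q (ys₁ ++ y ∷ ys₂) ≡ suc (count Q (ys₁ ++ ys₂))
    count-remove Q [] qy rewrite qy = refl
    count-remove Q (w ∷ ys₁) qy with Q w
    ... | true = cong suc (count-remove Q ys₁ qy)
    ... | false = count-remove Q ys₁ qy

  count-≤-injection : ∀ (P Q : A → Bool) (f : A → A) xs ys → Distinct xs → Distinct ys →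
    (∀ x → x ∈ xs → P x ≡ true → f x ∈ ys × Q (f x) ≡ true) →
    (∀ x x' → x ∈ xs → x' ∈ xs → P x ≡ true → P x' ≡ true → f x ≡ f x' → x ≡ x') →
    count P xs ≤ count Q ys
  count-≤-injection P Q f [] ys _ _ _ _ = z≤n
  count-≤-injection P Q f (x ∷ xs) ys (x∉ , ndxs) ndys into inj with P x in eq
  ... | false = count-≤-injection P Q f xs ys ndxs ndys (λ z z∈ pz → into z (there z∈) pz)
                  (λ z z' a b c d e → inj z z' (there a) (there b) c d e)
  ... | true with ∈-∃++ (proj₁ (into x (here refl) eq)) | proj₂ (into x (here refl) eq)
  ...   | ys₁ , ys₂ , refl | qfx =
    subst (suc (count P xs) ≤_) (sym (count-remove Q ys₁ qfx))
      (s≤s (count-≤-injection P Q f xs (ys₁ ++ ys₂) ndxs (Distinct-remove ys₁ ndys)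
        (λ z z∈ pz → ∈-remove ys₁ (proj₁ (into z (there z∈) pz))
             (λ e → x∉ (subst (_∈ xs) (inj z x (there z∈) (here refl) pz eq e) z∈))
           , proj₂ (into z (there z∈) pz))
        (λ z z' a b c d e → inj z z' (there a) (there b) c d e)))

  count-bijection : ∀ (P Q : A → Bool) (f g : A → A) xs ys → Distinct xs → Distinct ys →
    (∀ x → x ∈ xs → P x ≡ true → f x ∈ ys × Q (f x) ≡ true × g (f x) ≡ x) →
    (∀ y → y ∈ ys → Q y ≡ true → g y ∈ xs × P (g y) ≡ true × f (g y) ≡ y) →
    count P xs ≡ count Q ys
  count-bijection P Q f g xs ys ndx ndy fwd bwd = ≤-antisym
    (count-≤-injection P Q f xs ys ndx ndy (λ x a b → proj₁ (fwd x a b) , proj₁ (proj₂ (fwd x a b)))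
      (λ x x' a b c d e → trans (sym (proj₂ (proj₂ (fwd x a c))))
                           (trans (cong g e) (proj₂ (proj₂ (fwd x' b d))))))
    (count-≤-injection Q P g ys xs ndy ndx (λ y a b → proj₁ (bwd y a b) , proj₁ (proj₂ (bwd y a b)))
      (λ y y' a b c d e → trans (sym (proj₂ (proj₂ (bwd y a c))))
                           (trans (cong f e) (proj₂ (proj₂ (bwd y' b d))))))

  count-split : ∀ (P Q : A → Bool) xs →
    count P xs ≡ count (λ x → P x ∧ Q x) xs + count (λ x → P x ∧ not (Q x)) xs
  count-split P Q [] = refl
  count-split P Q (x ∷ xs) with P x | Q x
  ... | true | true = cong suc (count-split P Q xs)
  ... | true | false = trans (cong suc (count-split P Q xs)) (sym (+-suc _ _))
  ... | false | _ = count-split P Q xs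

  count-cong : ∀ (P Q : A → Bool) xs → (∀ x → x ∈ xs → P x ≡ Q x) → count P xs ≡ count Q xs
  count-cong P Q [] h = refl
  count-cong P Q (x ∷ xs) h rewrite h x (here refl) =
    cong (λ k → if Q x then suc k else k) (count-cong P Q xs (λ z z∈ → h z (there z∈)))

  count-none : ∀ (P : A → Bool) xs → (∀ x → x ∈ xs → P x ≡ false) → count P xs ≡ 0
  count-none P [] h = refl
  count-none P (x ∷ xs) h rewrite h x (here refl) = count-none P xs (λ z z∈ → h z (there z∈))

  Distinct-++ : ∀ (xs ys : List A) → Distinct xs → Distinct ys → (∀ z → z ∈ xs → z ∉ ys) →
    Distinct (xs ++ ys)
  Distinct-++ [] ys _ ndy _ = ndy
  Distinct-++ (x ∷ xs) ys (x∉ , ndx) ndy d =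
    (λ p → [ x∉ , d x (here refl) ]′ (∈-++⁻ xs p)) , Distinct-++ xs ys ndx ndy (λ z z∈ → d z (there z∈))

  Distinct-map : ∀ (f : A → A) xs → (∀ {a b} → f a ≡ f b → a ≡ b) → Distinct xs → Distinct (map f xs)
  Distinct-map f [] inj _ = tt
  Distinct-map f (x ∷ xs) inj (x∉ , nd) =
    (λ p → let (z , z∈ , e) = ∈-map⁻ f p in x∉ (subst (_∈ xs) (sym (inj e)) z∈)) , Distinct-map f xs inj nd

  Distinct-concatMap : ∀ (f : A → List A) xs → Distinct xs → (∀ τ → τ ∈ xs → Distinct (f τ)) →
    (∀ τ τ' σ → τ ∈ xs → τ' ∈ xs → σ ∈ f τ → σ ∈ f τ' → τ ≡ τ') → Distinct (concatMap f xs)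
  Distinct-concatMap f [] _ _ _ = tt
  Distinct-concatMap f (τ ∷ xs) (τ∉ , nd) H D =
    Distinct-++ (f τ) (concatMap f xs) (H τ (here refl))
      (Distinct-concatMap f xs nd (λ τ' p → H τ' (there p)) (λ a b c d e g h → D a b c (there d) (there e) g h))
      (λ σ σ∈ σ∈' → let (τ' , τ'∈ , σ∈τ') = find (∈-concatMap⁻ f {xs = xs} σ∈') in
         τ∉ (subst (_∈ xs) (sym (D τ τ' σ (here refl) (there τ'∈) σ∈ σ∈τ')) τ'∈))

count-by-key : ∀ {A : Set} (P : A → Bool) (key : A → ℕ) xs ks c → Distinct ks →
  (∀ x → x ∈ xs → P x ≡ true → key x ∈ ks) →
  (∀ k → k ∈ ks → count (λ x → P x ∧ (key x ≡ᵇ k)) xs ≡ c) →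
  count P xs ≡ length ks * c
count-by-key P key xs [] c _ keyed _ = count-none P xs (λ x x∈ → unkeyed x x∈ (P x) refl)
  where
  unkeyed : ∀ x → x ∈ xs → ∀ b → P x ≡ b → P x ≡ false
  unkeyed x x∈ true e with keyed x x∈ e
  ... | ()
  unkeyed x x∈ false e = e
count-by-key P key xs (k ∷ ks) c (k∉ , nd) keyed size =
  trans (count-split P (λ x → key x ≡ᵇ k) xs)
    (cong₂ _+_ (size k (here refl))
      (count-by-key (λ x → P x ∧ not (key x ≡ᵇ k)) key xs ks c nd keyed′
        (λ k' k'∈ → trans (count-cong _ _ xs (λ x _ → drop-≢ k' k'∈ x)) (size k' (there k'∈)))))
  where
  keyed′ : ∀ x → x ∈ xs → (P x ∧ not (key x ≡ᵇ k)) ≡ true → key x ∈ ks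
  keyed′ x x∈ e with keyed x x∈ (∧-trueˡ e)
  ... | here e' = ⊥-elim (≡ᵇ-false⇒≢ (not-true⁻ (∧-trueʳ {P x} e)) e')
  ... | there p = p
  drop-≢ : ∀ k' → k' ∈ ks → ∀ x →
    ((P x ∧ not (key x ≡ᵇ k)) ∧ (key x ≡ᵇ k')) ≡ (P x ∧ (key x ≡ᵇ k'))
  drop-≢ k' k'∈ x with key x ≡ᵇ k' in e1
  ... | false = trans (∧-zeroʳ _) (sym (∧-zeroʳ _))
  ... | true rewrite ≢⇒≡ᵇ-false {key x} {k}
                       (λ e → k∉ (subst (_∈ ks) (trans (sym (≡ᵇ-true⇒≡ {key x} {k'} e1)) e) k'∈)) =
    cong (_∧ true) (∧-identityʳ (P x))

occ : ℕ → List ℕ → ℕ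
occ x [] = 0
occ x (y ∷ ys) = if x ≡ᵇ y then suc (occ x ys) else occ x ys

occ-++ : ∀ x xs ys → occ x (xs ++ ys) ≡ occ x xs + occ x ys
occ-++ x [] ys = refl
occ-++ x (y ∷ xs) ys with x ≡ᵇ y
... | true = cong suc (occ-++ x xs ys)
... | false = occ-++ x xs ys

occ-here : ∀ x ys → occ x (x ∷ ys) ≡ suc (occ x ys)
occ-here x ys rewrite ≡ᵇ-refl x = refl

occ-ne : ∀ {x y} ys → x ≢ y → occ x (y ∷ ys) ≡ occ x ys
occ-ne {x} {y} ys ne rewrite ≢⇒≡ᵇ-false ne = refl

occ-∷-≥ : ∀ x y ys → occ x ys ≤ occ x (y ∷ ys)
occ-∷-≥ x y ys with x ≡ᵇ y
... | true = n≤1+n _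
... | false = ≤-refl

∈⇒occ≥1 : ∀ {x xs} → x ∈ xs → 1 ≤ occ x xs
∈⇒occ≥1 {x} {y ∷ ys} (here refl) rewrite ≡ᵇ-refl x = s≤s z≤n
∈⇒occ≥1 {x} {y ∷ ys} (there p) = ≤-trans (∈⇒occ≥1 p) (occ-∷-≥ x y ys)

occ≥1⇒∈ : ∀ {x} xs → 1 ≤ occ x xs → x ∈ xs
occ≥1⇒∈ {x} (y ∷ ys) h with x ≡ᵇ y in e
... | true = here (≡ᵇ-true⇒≡ e)
... | false = there (occ≥1⇒∈ ys h)

∉⇒occ≡0 : ∀ {x} xs → x ∉ xs → occ x xs ≡ 0
∉⇒occ≡0 {x} xs nin with occ x xs in e
... | zero = refl
... | suc _ = ⊥-elim (nin (occ≥1⇒∈ xs (subst (1 ≤_) (sym e) (s≤s z≤n))))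

occ≡0⇒∉ : ∀ {x} xs → occ x xs ≡ 0 → x ∉ xs
occ≡0⇒∉ xs e x∈ with subst (1 ≤_) e (∈⇒occ≥1 x∈)
... | ()

occ-insert : ∀ y pre x post → occ y (pre ++ x ∷ post) ≡ occ y (x ∷ []) + occ y (pre ++ post)
occ-insert y pre x post rewrite occ-++ y pre (x ∷ post) | occ-++ y pre post with y ≡ᵇ x
... | true = +-suc _ _
... | false = refl

occ-++-middle : ∀ x X B Y → occ x (X ++ B ++ Y) ≡ occ x B + occ x (X ++ Y)
occ-++-middle x X B Y = begin
  occ x (X ++ B ++ Y)           ≡⟨ occ-++ x X (B ++ Y) ⟩
  occ x X + occ x (B ++ Y)      ≡⟨ cong (occ x X +_) (occ-++ x B Y) ⟩
  occ x X + (occ x B + occ x Y) ≡⟨ rearrange (occ x X) (occ x B) (occ x Y) ⟩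
  occ x B + (occ x X + occ x Y) ≡⟨ cong (occ x B +_) (sym (occ-++ x X Y)) ⟩
  occ x B + occ x (X ++ Y)      ∎
  where
  open ≡-Reasoning
  rearrange : ∀ a b c → a + (b + c) ≡ b + (a + c)
  rearrange = solve-∀

occ-reverse : ∀ x L → occ x (reverse L) ≡ occ x L
occ-reverse x [] = refl
occ-reverse x (y ∷ L) rewrite List.unfold-reverse y L | occ-++ x (reverse L) (y ∷ []) | occ-reverse x L
  with x ≡ᵇ y
... | true = +-comm _ 1
... | false = +-identityʳ _

occ-map-injective : ∀ (h : ℕ → ℕ) → (∀ {a b} → h a ≡ h b → a ≡ b) → ∀ y L → occ (h y) (map h L) ≡ occ y L
occ-map-injective h h-inj y [] = refl
occ-map-injective h h-inj y (z ∷ L) with h y ≡ᵇ h z in e1 | y ≡ᵇ z in e2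
... | true | true = cong suc (occ-map-injective h h-inj y L)
... | false | false = occ-map-injective h h-inj y L
... | true | false = ⊥-elim (≡ᵇ-false⇒≢ e2 (h-inj (≡ᵇ-true⇒≡ e1)))
... | false | true = ⊥-elim (≡ᵇ-false⇒≢ e1 (cong h (≡ᵇ-true⇒≡ e2)))

occ-map-∉ : ∀ (h : ℕ → ℕ) x L → (∀ z → h z ≢ x) → occ x (map h L) ≡ 0
occ-map-∉ h x [] a = refl
occ-map-∉ h x (z ∷ L) a rewrite ≢⇒≡ᵇ-false {x} {h z} (λ e → a z (sym e)) = occ-map-∉ h x L a

AtMostOnce : List ℕ → Set
AtMostOnce σ = ∀ x → occ x σ ≤ 1

occ≤1⇒∉-around : ∀ x xs ys → occ x (xs ++ x ∷ ys) ≤ 1 → x ∉ xs × x ∉ ys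
occ≤1⇒∉-around x xs ys h rewrite occ-++ x xs (x ∷ ys) | occ-here x ys | +-suc (occ x xs) (occ x ys) =
  occ≡0⇒∉ xs (m+n≡0⇒m≡0 (occ x xs) (n≤0⇒n≡0 (≤-pred h))) ,
  occ≡0⇒∉ ys (m+n≡0⇒n≡0 (occ x xs) (n≤0⇒n≡0 (≤-pred h)))

occ≤1⇒split-unique : ∀ x xs ys xs' ys' → occ x (xs ++ x ∷ ys) ≤ 1 → xs ++ x ∷ ys ≡ xs' ++ x ∷ ys' →
  xs ≡ xs' × ys ≡ ys'
occ≤1⇒split-unique x [] ys [] ys' h eq = refl , proj₂ (∷-injective eq)
occ≤1⇒split-unique x [] ys (z ∷ xs') ys' h eq =
  ⊥-elim (proj₂ (occ≤1⇒∉-around x [] ys h) (subst (x ∈_) (sym (proj₂ (∷-injective eq))) (∈-++⁺ʳ xs' (here refl))))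
occ≤1⇒split-unique x (z ∷ xs) ys [] ys' h eq =
  ⊥-elim (proj₁ (occ≤1⇒∉-around x (z ∷ xs) ys h) (here (sym (proj₁ (∷-injective eq)))))
occ≤1⇒split-unique x (z ∷ xs) ys (z' ∷ xs') ys' h eq with ∷-injective eq
... | refl , eq' with occ≤1⇒split-unique x xs ys xs' ys' (≤-trans (occ-∷-≥ x z (xs ++ x ∷ ys)) h) eq'
...   | refl , refl = refl , refl

AtMostOnce-tail : ∀ {x xs} → AtMostOnce (x ∷ xs) → AtMostOnce xs
AtMostOnce-tail {x} {xs} u y = ≤-trans (occ-∷-≥ y x xs) (u y)

AtMostOnce-head : ∀ {x xs} → AtMostOnce (x ∷ xs) → x ∉ xs
AtMostOnce-head {x} {xs} u = proj₂ (occ≤1⇒∉-around x [] xs (u x))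

AtMostOnce⇒Distinct : ∀ xs → AtMostOnce xs → Distinct xs
AtMostOnce⇒Distinct [] u = tt
AtMostOnce⇒Distinct (x ∷ xs) u = AtMostOnce-head {x} {xs} u , AtMostOnce⇒Distinct xs (AtMostOnce-tail {x} {xs} u)

All≢⇒occ≡0 : ∀ {x xs} → All (x ≢_) xs → occ x xs ≡ 0
All≢⇒occ≡0 [] = refl
All≢⇒occ≡0 {x} {y ∷ ys} (ne ∷ a) rewrite ≢⇒≡ᵇ-false ne = All≢⇒occ≡0 a

Unique⇒AtMostOnce : ∀ {xs} → Unique xs → AtMostOnce xs
Unique⇒AtMostOnce [] y = z≤n
Unique⇒AtMostOnce {x ∷ xs} (a ∷ u) y with y ≡ᵇ x in e
... | true rewrite ≡ᵇ-true⇒≡ {y} {x} e | All≢⇒occ≡0 a = s≤s z≤n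
... | false = Unique⇒AtMostOnce u y

AtMostOnce-map : ∀ (h unh : ℕ → ℕ) → (∀ z → unh (h z) ≡ z) → ∀ τ → AtMostOnce τ → AtMostOnce (map h τ)
AtMostOnce-map h unh inv τ u x with h (unh x) ≟ x
... | yes e = subst (_≤ 1) (sym (trans (cong (λ z → occ z (map h τ)) (sym e)) (occ-map-injective h h-inj (unh x) τ))) (u (unh x))
  where
  h-inj : ∀ {a b} → h a ≡ h b → a ≡ b
  h-inj {a} {b} e = trans (sym (inv a)) (trans (cong unh e) (inv b))
... | no ne = subst (_≤ 1) (sym (occ-map-∉ h x τ (λ z e → ne (trans (cong h (trans (cong unh (sym e)) (inv z))) e)))) z≤n

range-bound : ∀ a b i → i < suc b ∸ a → a + i ≤ b
range-bound a b i h with a ≤? suc b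
... | yes a≤ = ≤-pred (≤-trans (≤-reflexive (sym (+-suc a i))) (≤-trans (+-monoʳ-≤ a h) (≤-reflexive (m+[n∸m]≡n a≤))))
... | no a≰ with subst (i <_) (m≤n⇒m∸n≡0 (<⇒≤ (≰⇒> a≰))) h
...   | ()

∈-range⁻ : ∀ {x} a b → x ∈ range a b → a ≤ x × x ≤ b
∈-range⁻ a b x∈ with ∈-map⁻ (a +_) x∈
... | i , i∈ , refl = m≤m+n a i , range-bound a b i (∈-upTo⁻ i∈)

∈-range⁺ : ∀ {x} a b → a ≤ x → x ≤ b → x ∈ range a b
∈-range⁺ {x} a b a≤x x≤b = subst (_∈ range a b) (m+[n∸m]≡n a≤x)
  (∈-map⁺ (a +_) (∈-upTo⁺ (∸-monoˡ-< (s≤s x≤b) a≤x)))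

range-AtMostOnce : ∀ a b → AtMostOnce (range a b)
range-AtMostOnce a b = Unique⇒AtMostOnce (Unique.map⁺ (λ {x} {y} e → +-cancelˡ-≡ a x y e) (Unique.upTo⁺ (suc b ∸ a)))

occ-range-in : ∀ {x} a b → a ≤ x → x ≤ b → occ x (range a b) ≡ 1
occ-range-in {x} a b h1 h2 = ≤-antisym (range-AtMostOnce a b x) (∈⇒occ≥1 (∈-range⁺ a b h1 h2))

occ-range-out : ∀ {x} a b → ¬ (a ≤ x × x ≤ b) → occ x (range a b) ≡ 0
occ-range-out a b h = ∉⇒occ≡0 (range a b) (λ x∈ → h (∈-range⁻ a b x∈))

length-range : ∀ a b → length (range a b) ≡ suc b ∸ a
length-range a b = trans (List.length-map (a +_) (upTo (suc b ∸ a))) (List.length-upTo _)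

-- Permutations of [k], described by the multiplicity of every value

PermOf : ℕ → List ℕ → Set
PermOf k σ = ∀ x → occ x σ ≡ occ x [ k ]

↭⇒PermOf : ∀ {k σ} → σ Perm.↭ [ k ] → PermOf k σ
↭⇒PermOf p x = occ-↭ p
  where
  occ-↭ : ∀ {xs ys : List ℕ} → xs Perm.↭ ys → occ x xs ≡ occ x ys
  occ-↭ Perm.refl = refl
  occ-↭ (Perm.prep y p) with x ≡ᵇ y
  ... | true = cong suc (occ-↭ p)
  ... | false = occ-↭ p
  occ-↭ (Perm.swap y z p) with x ≡ᵇ y | x ≡ᵇ z
  ... | true | true = cong (λ k → suc (suc k)) (occ-↭ p)
  ... | true | false = cong suc (occ-↭ p)
  ... | false | true = cong suc (occ-↭ p)
  ... | false | false = occ-↭ p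
  occ-↭ (Perm.trans p q) = trans (occ-↭ p) (occ-↭ q)

PermOf⇒AtMostOnce : ∀ {k σ} → PermOf k σ → AtMostOnce σ
PermOf⇒AtMostOnce {k} p x = subst (_≤ 1) (sym (p x)) (range-AtMostOnce 1 k x)

occ-[]-in : ∀ {x} k → 1 ≤ x → x ≤ k → occ x [ k ] ≡ 1
occ-[]-in k = occ-range-in 1 k

occ-[]-out : ∀ {x} k → ¬ (1 ≤ x × x ≤ k) → occ x [ k ] ≡ 0
occ-[]-out k = occ-range-out 1 k

occ-[]-cong : ∀ a k b k' → ((1 ≤ a × a ≤ k) → (1 ≤ b × b ≤ k')) → ((1 ≤ b × b ≤ k') → (1 ≤ a × a ≤ k)) →
  occ a [ k ] ≡ occ b [ k' ]
occ-[]-cong a k b k' f g with 1 ≤? a | a ≤? k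
... | yes p | yes q = trans (occ-[]-in k p q) (sym (occ-[]-in k' (proj₁ (f (p , q))) (proj₂ (f (p , q)))))
... | no p | _ = trans (occ-[]-out k (λ (u , _) → p u)) (sym (occ-[]-out k' (λ h → p (proj₁ (g h)))))
... | yes _ | no q = trans (occ-[]-out k (λ (_ , v) → q v)) (sym (occ-[]-out k' (λ h → q (proj₂ (g h)))))

occ-[suc] : ∀ k y → occ y [ suc k ] ≡ occ y (suc k ∷ []) + occ y [ k ]
occ-[suc] k y with y ≟ suc k
... | yes refl rewrite occ-here (suc k) [] | occ-[]-in (suc k) (s≤s z≤n) (≤-refl {suc k})
          | occ-[]-out {suc k} k (λ (_ , h) → 1+n≰n h) = refl
... | no ne rewrite occ-ne {y} {suc k} [] ne with y
...   | zero rewrite occ-[]-out {0} (suc k) (λ ()) | occ-[]-out {0} k (λ ()) = refl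
...   | suc y' with suc y' ≤? k
...     | yes le rewrite occ-[]-in (suc k) (s≤s z≤n) (m≤n⇒m≤1+n le) | occ-[]-in k (s≤s z≤n) le = refl
...     | no nle rewrite occ-[]-out {suc y'} k (λ (_ , h) → nle h) =
            occ-[]-out (suc k) (λ (_ , h) → ne (≤-antisym h (≰⇒> nle)))

PermOf-bounds : ∀ {k σ x} → PermOf k σ → x ∈ σ → 1 ≤ x × x ≤ k
PermOf-bounds {k} {σ} {x} p x∈ with 1 ≤? x | x ≤? k
... | yes a | yes b = a , b
... | no a | _ = ⊥-elim (occ≡0⇒∉ σ (trans (p x) (occ-[]-out k (λ (u , _) → a u))) x∈)
... | _ | no b = ⊥-elim (occ≡0⇒∉ σ (trans (p x) (occ-[]-out k (λ (_ , v) → b v))) x∈)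

PermOf-∈ : ∀ {k σ x} → PermOf k σ → 1 ≤ x → x ≤ k → x ∈ σ
PermOf-∈ {k} {σ} {x} p a b = occ≥1⇒∈ σ (≤-reflexive (sym (trans (p x) (occ-[]-in k a b))))

∈-insertions⁻ : ∀ {σ} x τ → σ ∈ insertions x τ → ∃₂ λ pre post → τ ≡ pre ++ post × σ ≡ pre ++ x ∷ post
∈-insertions⁻ x [] (here refl) = [] , [] , refl , refl
∈-insertions⁻ x (y ∷ ys) (here refl) = [] , y ∷ ys , refl , refl
∈-insertions⁻ x (y ∷ ys) (there p) with ∈-map⁻ (y ∷_) p
... | σ' , σ'∈ , refl with ∈-insertions⁻ x ys σ'∈
...   | pre , post , refl , refl = y ∷ pre , post , refl , refl

∈-insertions⁺ : ∀ x pre post → pre ++ x ∷ post ∈ insertions x (pre ++ post)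
∈-insertions⁺ x [] [] = here refl
∈-insertions⁺ x [] (y ∷ post) = here refl
∈-insertions⁺ x (z ∷ pre) post = there (∈-map⁺ (z ∷_) (∈-insertions⁺ x pre post))

insertions-distinct : ∀ x τ → x ∉ τ → Distinct (insertions x τ)
insertions-distinct x [] _ = (λ ()) , tt
insertions-distinct x (y ∷ ys) x∉ =
  (λ p → let (_ , _ , e) = ∈-map⁻ (y ∷_) p in x∉ (here (proj₁ (∷-injective e)))) ,
  Distinct-map (y ∷_) (insertions x ys) (λ e → proj₂ (∷-injective e)) (insertions-distinct x ys (λ p → x∉ (there p)))

insertions-disjoint : ∀ x τ τ' σ → x ∉ τ → x ∉ τ' → σ ∈ insertions x τ → σ ∈ insertions x τ' → τ ≡ τ'
insertions-disjoint x τ τ' σ n1 n2 p1 p2 with ∈-insertions⁻ x τ p1 | ∈-insertions⁻ x τ' p2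
... | pre , post , refl , refl | pre' , post' , refl , e
  with occ≤1⇒split-unique x pre post pre' post'
         (subst (_≤ 1) (sym (trans (occ-insert x pre x post) (cong (occ x (x ∷ []) +_) (∉⇒occ≡0 (pre ++ post) n1))))
           (≤-reflexive (trans (+-identityʳ _) (occ-here x [])))) e
...   | refl , refl = refl

perms-sound : ∀ k σ → σ ∈ perms k → PermOf k σ
perms-sound zero .[] (here refl) x = refl
perms-sound (suc k) σ p y with find (∈-concatMap⁻ (insertions (suc k)) {xs = perms k} p)
... | τ , τ∈ , σ∈ with ∈-insertions⁻ (suc k) τ σ∈
...   | pre , post , refl , refl =
  trans (occ-insert y pre (suc k) post)
    (trans (cong (occ y (suc k ∷ []) +_) (perms-sound k (pre ++ post) τ∈ y)) (sym (occ-[suc] k y)))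

suc∉perms : ∀ k τ → τ ∈ perms k → suc k ∉ τ
suc∉perms k τ τ∈ = occ≡0⇒∉ τ (trans (perms-sound k τ τ∈ (suc k)) (occ-[]-out k (λ (_ , h) → 1+n≰n h)))

perms-complete : ∀ k σ → PermOf k σ → σ ∈ perms k
perms-complete zero [] p = here refl
perms-complete zero (y ∷ σ) p with subst (1 ≤_) (p y) (∈⇒occ≥1 {y} {y ∷ σ} (here refl))
... | ()
perms-complete (suc k) σ p with ∈-∃++ (PermOf-∈ {suc k} {σ} p (s≤s z≤n) ≤-refl)
... | pre , post , refl =
  ∈-concatMap⁺ (insertions (suc k)) {xs = perms k}
    (lose (perms-complete k (pre ++ post) λ y →
       +-cancelˡ-≡ (occ y (suc k ∷ [])) _ _ (trans (sym (occ-insert y pre (suc k) post)) (trans (p y) (occ-[suc] k y))))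
     (∈-insertions⁺ (suc k) pre post))

perms-distinct : ∀ k → Distinct (perms k)
perms-distinct zero = (λ ()) , tt
perms-distinct (suc k) = Distinct-concatMap (insertions (suc k)) (perms k) (perms-distinct k)
  (λ τ τ∈ → insertions-distinct (suc k) τ (suc∉perms k τ τ∈))
  (λ τ τ' σ a b c d → insertions-disjoint (suc k) τ τ' σ (suc∉perms k τ a) (suc∉perms k τ' b) c d)

map-inverse : ∀ (f g : ℕ → ℕ) L → (∀ z → z ∈ L → g (f z) ≡ z) → map g (map f L) ≡ L
map-inverse f g [] h = refl
map-inverse f g (z ∷ L) h = cong₂ _∷_ (h z (here refl)) (map-inverse f g L (λ w p → h w (there p)))

∈-++-∷⇔ : ∀ {x e : ℕ} xs ys → x ∈ xs ++ e ∷ ys ⇔ (x ∈ xs ++ ys ⊎ x ≡ e)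
∈-++-∷⇔ {x} {e} xs ys = mk⇔ (split xs) (join xs)
  where
  split : ∀ xs → x ∈ xs ++ e ∷ ys → x ∈ xs ++ ys ⊎ x ≡ e
  split [] (here x≡e) = inj₂ x≡e
  split [] (there q) = inj₁ q
  split (z ∷ xs) (here x≡z) = inj₁ (here x≡z)
  split (z ∷ xs) (there q) = map₁ there (split xs q)
  join : ∀ xs → x ∈ xs ++ ys ⊎ x ≡ e → x ∈ xs ++ e ∷ ys
  join [] (inj₁ q) = there q
  join [] (inj₂ x≡e) = here x≡e
  join (z ∷ xs) (inj₁ (here x≡z)) = here x≡z
  join (z ∷ xs) (inj₁ (there q)) = there (join xs (inj₁ q))
  join (z ∷ xs) (inj₂ x≡e) = there (join xs (inj₂ x≡e))

-- Pinnacles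

∈-Pin⁻ : ∀ {x} σ → x ∈ Pin σ → ∃₂ λ pre a → ∃₂ λ b post → σ ≡ pre ++ a ∷ x ∷ b ∷ post × a < x × b < x
∈-Pin⁻ {x} (a ∷ b ∷ c ∷ r) x∈ with ∈-Pin⁻ {x} (b ∷ c ∷ r)
... | ih with (a <ᵇ b) ∧ (c <ᵇ b) in e
∈-Pin⁻ (a ∷ b ∷ c ∷ r) (here refl) | ih | true = [] , a , c , r , refl , <ᵇ-true⇒< (∧-trueˡ e) , <ᵇ-true⇒< (∧-trueʳ {a <ᵇ b} e)
∈-Pin⁻ (a ∷ b ∷ c ∷ r) (there x∈) | ih | true with ih x∈
... | pre , a' , b' , post , eq , h1 , h2 = a ∷ pre , a' , b' , post , cong (a ∷_) eq , h1 , h2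
∈-Pin⁻ (a ∷ b ∷ c ∷ r) x∈ | ih | false with ih x∈
... | pre , a' , b' , post , eq , h1 , h2 = a ∷ pre , a' , b' , post , cong (a ∷_) eq , h1 , h2

Pin-tail : ∀ {x} a r → x ∈ Pin (a ∷ r) → x ∈ r
Pin-tail {x} a (b ∷ c ∷ r) x∈ with Pin-tail {x} b (c ∷ r)
... | ih with (a <ᵇ b) ∧ (c <ᵇ b)
Pin-tail a (b ∷ c ∷ r) (here refl) | ih | true = here refl
Pin-tail a (b ∷ c ∷ r) (there x∈) | ih | true = there (ih x∈)
Pin-tail a (b ∷ c ∷ r) x∈ | ih | false = there (ih x∈)

head∉Pin : ∀ {x} b r → AtMostOnce (b ∷ r) → x ∈ Pin (b ∷ r) → x ≢ b
head∉Pin b r u x∈ refl = AtMostOnce-head u (Pin-tail b r x∈)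

Pin-++ : ∀ xs y z ys → Pin (xs ++ y ∷ z ∷ ys) ≡ Pin (xs ++ y ∷ z ∷ []) ++ Pin (y ∷ z ∷ ys)
Pin-++ [] y z ys = refl
Pin-++ (a ∷ []) y z ys with (a <ᵇ y) ∧ (z <ᵇ y)
... | true = refl
... | false = refl
Pin-++ (a ∷ b ∷ []) y z ys with Pin-++ (b ∷ []) y z ys
... | ih with (a <ᵇ b) ∧ (y <ᵇ b)
...   | true = cong (b ∷_) ih
...   | false = ih
Pin-++ (a ∷ b ∷ c ∷ xs) y z ys with Pin-++ (b ∷ c ∷ xs) y z ys
... | ih with (a <ᵇ b) ∧ (c <ᵇ b)
...   | true = cong (b ∷_) ih
...   | false = ih

Pin-++-ascent : ∀ xs y z ys → y < z → Pin (xs ++ y ∷ z ∷ ys) ≡ Pin (xs ++ y ∷ []) ++ Pin (y ∷ z ∷ ys)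
Pin-++-ascent [] y z ys h = refl
Pin-++-ascent (a ∷ []) y z ys h rewrite ≮⇒<ᵇ-false {z} {y} (<⇒≯ h) | ∧-zeroʳ (a <ᵇ y) = refl
Pin-++-ascent (a ∷ b ∷ []) y z ys h with Pin-++-ascent (b ∷ []) y z ys h
... | ih with (a <ᵇ b) ∧ (y <ᵇ b)
...   | true = cong (b ∷_) ih
...   | false = ih
Pin-++-ascent (a ∷ b ∷ c ∷ xs) y z ys h with Pin-++-ascent (b ∷ c ∷ xs) y z ys h
... | ih with (a <ᵇ b) ∧ (c <ᵇ b)
...   | true = cong (b ∷_) ih
...   | false = ih

Pin-descent : ∀ c b L → b < c → Pin (c ∷ b ∷ L) ≡ Pin (b ∷ L)
Pin-descent c b [] b<c = refl
Pin-descent c b (d ∷ L) b<c rewrite ≮⇒<ᵇ-false {c} {b} (<⇒≯ b<c) = refl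

Pin-ascent : ∀ a y z L → y < z → Pin (a ∷ y ∷ z ∷ L) ≡ Pin (y ∷ z ∷ L)
Pin-ascent a y z L y<z rewrite ≮⇒<ᵇ-false {z} {y} (<⇒≯ y<z) | ∧-zeroʳ (a <ᵇ y) = refl

Pin-peak : ∀ a x b L → a < x → b < x → Pin (a ∷ x ∷ b ∷ L) ≡ x ∷ Pin (b ∷ L)
Pin-peak a x b L a<x b<x rewrite <⇒<ᵇ-true a<x | <⇒<ᵇ-true b<x = cong (x ∷_) (Pin-descent x b L b<x)

Pin-insert-ascent : ∀ pre a y z b post → a < y → y < z → b < z →
  Pin (pre ++ a ∷ y ∷ z ∷ b ∷ post) ≡ Pin (pre ++ a ∷ z ∷ b ∷ post)
Pin-insert-ascent pre a y z b post a<y y<z b<z = begin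
  Pin (pre ++ a ∷ y ∷ z ∷ b ∷ post)                 ≡⟨ Pin-++-ascent pre a y (z ∷ b ∷ post) a<y ⟩
  Pin (pre ++ a ∷ []) ++ Pin (a ∷ y ∷ z ∷ b ∷ post) ≡⟨ cong (Pin (pre ++ a ∷ []) ++_) (Pin-ascent a y z (b ∷ post) y<z) ⟩
  Pin (pre ++ a ∷ []) ++ Pin (y ∷ z ∷ b ∷ post)     ≡⟨ cong (Pin (pre ++ a ∷ []) ++_) (Pin-peak y z b post y<z b<z) ⟩
  Pin (pre ++ a ∷ []) ++ z ∷ Pin (b ∷ post)         ≡⟨ cong (Pin (pre ++ a ∷ []) ++_) (sym (Pin-peak a z b post a<z b<z)) ⟩
  Pin (pre ++ a ∷ []) ++ Pin (a ∷ z ∷ b ∷ post)     ≡⟨ sym (Pin-++-ascent pre a z (b ∷ post) a<z) ⟩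
  Pin (pre ++ a ∷ z ∷ b ∷ post)                     ∎
  where
  open ≡-Reasoning
  a<z : a < z
  a<z = <-trans a<y y<z

Pin-insert-after-peak : ∀ pre c a y z b post → c < a → y < a → y < z → b < z → b < a →
  ∀ x → x ∈ Pin (pre ++ c ∷ a ∷ y ∷ z ∷ b ∷ post) ⇔ (x ∈ Pin (pre ++ c ∷ a ∷ b ∷ post) ⊎ x ≡ z)
Pin-insert-after-peak pre c a y z b post c<a y<a y<z b<z b<a x =
  subst (λ l → x ∈ l ⇔ (x ∈ Pin (pre ++ c ∷ a ∷ b ∷ post) ⊎ x ≡ z)) (sym with-peak)
    (subst (λ l → x ∈ Q ++ z ∷ R ⇔ (x ∈ l ⊎ x ≡ z)) (sym without-peak) (∈-++-∷⇔ Q R))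
  where
  open ≡-Reasoning
  Q R : List ℕ
  Q = Pin (pre ++ c ∷ a ∷ []) ++ a ∷ []
  R = Pin (b ∷ post)
  with-peak : Pin (pre ++ c ∷ a ∷ y ∷ z ∷ b ∷ post) ≡ Q ++ z ∷ R
  with-peak = begin
    Pin (pre ++ c ∷ a ∷ y ∷ z ∷ b ∷ post)                   ≡⟨ Pin-++ pre c a (y ∷ z ∷ b ∷ post) ⟩
    Pin (pre ++ c ∷ a ∷ []) ++ Pin (c ∷ a ∷ y ∷ z ∷ b ∷ post) ≡⟨ cong (Pin (pre ++ c ∷ a ∷ []) ++_) (Pin-peak c a y (z ∷ b ∷ post) c<a y<a) ⟩
    Pin (pre ++ c ∷ a ∷ []) ++ a ∷ Pin (y ∷ z ∷ b ∷ post)   ≡⟨ cong (λ l → Pin (pre ++ c ∷ a ∷ []) ++ a ∷ l) (Pin-peak y z b post y<z b<z) ⟩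
    Pin (pre ++ c ∷ a ∷ []) ++ a ∷ z ∷ R                    ≡⟨ sym (++-assoc (Pin (pre ++ c ∷ a ∷ [])) (a ∷ []) (z ∷ R)) ⟩
    Q ++ z ∷ R                                              ∎
  without-peak : Pin (pre ++ c ∷ a ∷ b ∷ post) ≡ Q ++ R
  without-peak = begin
    Pin (pre ++ c ∷ a ∷ b ∷ post)                   ≡⟨ Pin-++ pre c a (b ∷ post) ⟩
    Pin (pre ++ c ∷ a ∷ []) ++ Pin (c ∷ a ∷ b ∷ post) ≡⟨ cong (Pin (pre ++ c ∷ a ∷ []) ++_) (Pin-peak c a b post c<a b<a) ⟩
    Pin (pre ++ c ∷ a ∷ []) ++ a ∷ R                ≡⟨ sym (++-assoc (Pin (pre ++ c ∷ a ∷ [])) (a ∷ []) R) ⟩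
    Q ++ R                                          ∎

Pin-neighbours : ∀ {x} σ pre post → AtMostOnce σ → x ∈ Pin σ → σ ≡ pre ++ x ∷ post →
  ∃₂ λ pre′ a → ∃₂ λ b post′ → pre ≡ pre′ ++ a ∷ [] × post ≡ b ∷ post′ × a < x × b < x
Pin-neighbours {x} σ pre post u x∈ σ≡ with ∈-Pin⁻ σ x∈
... | pre′ , a , b , post′ , σ≡′ , a<x , b<x
  with occ≤1⇒split-unique x pre post (pre′ ++ a ∷ []) (b ∷ post′) (subst (λ l → occ x l ≤ 1) σ≡ (u x))
         (trans (sym σ≡) (trans σ≡′ (sym (++-assoc pre′ (a ∷ []) (x ∷ b ∷ post′)))))
...   | pre≡ , post≡ = pre′ , a , b , post′ , pre≡ , post≡ , a<x , b<x

-- A pinnacle exceeds two distinct positive letters.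
Pin≥3 : ∀ k σ x → PermOf k σ → x ∈ Pin σ → 3 ≤ x
Pin≥3 k σ x P x∈ with ∈-Pin⁻ σ x∈
... | pre , a , b , post , refl , a<x , b<x with <-cmp a b
...   | tri< a<b _ _ = ≤-trans (s≤s (s≤s (proj₁ (PermOf-bounds {k} {σ} P (∈-++⁺ʳ pre (here refl)))))) (≤-trans (s≤s a<b) b<x)
...   | tri> _ _ b<a = ≤-trans (s≤s (s≤s (proj₁ (PermOf-bounds {k} {σ} P (∈-++⁺ʳ pre (there (there (here refl)))))))) (≤-trans (s≤s b<a) a<x)
...   | tri≈ _ refl _ = ⊥-elim (proj₂ (occ≤1⇒∉-around a pre (x ∷ a ∷ post) (PermOf⇒AtMostOnce {k} {σ} P a)) (there (here refl)))

AllAdjacent : (ℕ → ℕ → Set) → List ℕ → Set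
AllAdjacent R (a ∷ b ∷ r) = R a b × AllAdjacent R (b ∷ r)
AllAdjacent R _ = ⊤

AllAdjacent-mono : ∀ {R R' : ℕ → ℕ → Set} σ → (∀ a b → R a b → R' a b) → AllAdjacent R σ → AllAdjacent R' σ
AllAdjacent-mono [] f h = tt
AllAdjacent-mono (a ∷ []) f h = tt
AllAdjacent-mono (a ∷ b ∷ r) f (h , hs) = f a b h , AllAdjacent-mono (b ∷ r) f hs

AllAdjacent-universal : ∀ {R : ℕ → ℕ → Set} σ → (∀ a b → R a b) → AllAdjacent R σ
AllAdjacent-universal [] f = tt
AllAdjacent-universal (a ∷ []) f = tt
AllAdjacent-universal (a ∷ b ∷ r) f = f a b , AllAdjacent-universal (b ∷ r) f

AllAdjacent-× : ∀ {R R' : ℕ → ℕ → Set} σ → AllAdjacent R σ → AllAdjacent R' σ → AllAdjacent (λ a b → R a b × R' a b) σ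
AllAdjacent-× [] _ _ = tt
AllAdjacent-× (a ∷ []) _ _ = tt
AllAdjacent-× (a ∷ b ∷ r) (h , hs) (h' , hs') = (h , h') , AllAdjacent-× (b ∷ r) hs hs'

PreservesOrder : (ℕ → ℕ) → ℕ → ℕ → Set
PreservesOrder f a b = ((a <ᵇ b) ≡ (f a <ᵇ f b)) × ((b <ᵇ a) ≡ (f b <ᵇ f a))

Pin-map : ∀ f σ → AllAdjacent (PreservesOrder f) σ → Pin (map f σ) ≡ map f (Pin σ)
Pin-map f [] h = refl
Pin-map f (a ∷ []) h = refl
Pin-map f (a ∷ b ∷ []) h = refl
Pin-map f (a ∷ b ∷ c ∷ r) ((p1 , p2) , ((q1 , q2) , rest)) with Pin-map f (b ∷ c ∷ r) ((q1 , q2) , rest)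
... | ih rewrite sym p1 | sym q2 with (a <ᵇ b) ∧ (c <ᵇ b)
...   | true = cong (f b ∷_) ih
...   | false = ih

strictMono⇒PreservesOrder : ∀ f → (∀ a b → a < b → f a < f b) → ∀ a b → PreservesOrder f a b
strictMono⇒PreservesOrder f m a b = lem a b , lem b a
  where
  lem : ∀ u v → (u <ᵇ v) ≡ (f u <ᵇ f v)
  lem u v with u <? v | f u <? f v
  ... | yes h | _ = trans (<⇒<ᵇ-true h) (sym (<⇒<ᵇ-true (m u v h)))
  ... | no h | no h' = trans (≮⇒<ᵇ-false h) (sym (≮⇒<ᵇ-false h'))
  ... | no h | yes h' with <-cmp u v
  ...   | tri< u<v _ _ = ⊥-elim (h u<v)
  ...   | tri≈ _ refl _ = ⊥-elim (<-irrefl refl h')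
  ...   | tri> _ _ v<u = ⊥-elim (<-asym h' (m v u v<u))

reverse-∷∷ : ∀ (b c : ℕ) r → reverse (b ∷ c ∷ r) ≡ reverse r ++ c ∷ b ∷ []
reverse-∷∷ b c r = trans (List.unfold-reverse b (c ∷ r))
  (trans (cong (_++ b ∷ []) (List.unfold-reverse c r)) (++-assoc (reverse r) (c ∷ []) (b ∷ [])))

reverse-∷∷∷ : ∀ (a b c : ℕ) r → reverse (a ∷ b ∷ c ∷ r) ≡ reverse r ++ c ∷ b ∷ a ∷ []
reverse-∷∷∷ a b c r = trans (List.unfold-reverse a (b ∷ c ∷ r))
  (trans (cong (_++ a ∷ []) (reverse-∷∷ b c r)) (++-assoc (reverse r) (c ∷ b ∷ []) (a ∷ [])))

Pin-reverse : ∀ σ → Pin (reverse σ) ≡ reverse (Pin σ)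
Pin-reverse [] = refl
Pin-reverse (a ∷ []) = refl
Pin-reverse (a ∷ b ∷ []) = refl
Pin-reverse (a ∷ b ∷ c ∷ r) =
  trans (cong Pin (reverse-∷∷∷ a b c r)) (trans (Pin-++ (reverse r) c b (a ∷ []))
  (trans (cong (_++ Pin (c ∷ b ∷ a ∷ [])) (trans (cong Pin (sym (reverse-∷∷ b c r))) (Pin-reverse (b ∷ c ∷ r))))
    (lem (a <ᵇ b) (c <ᵇ b))))
  where
  lem : ∀ u v → reverse (Pin (b ∷ c ∷ r)) ++ (if v ∧ u then b ∷ [] else []) ≡
                reverse (if u ∧ v then b ∷ Pin (b ∷ c ∷ r) else Pin (b ∷ c ∷ r))
  lem true true = sym (List.unfold-reverse b (Pin (b ∷ c ∷ r)))
  lem true false = List.++-identityʳ _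
  lem false true = List.++-identityʳ _
  lem false false = List.++-identityʳ _

adjacentᵇ : ℕ → ℕ → List ℕ → Bool
adjacentᵇ x y (a ∷ b ∷ r) = ((a ≡ᵇ x) ∧ (b ≡ᵇ y)) ∨ adjacentᵇ x y (b ∷ r)
adjacentᵇ x y _ = false

adjacentᵇ⁻ : ∀ x y σ → adjacentᵇ x y σ ≡ true → ∃₂ λ pre post → σ ≡ pre ++ x ∷ y ∷ post
adjacentᵇ⁻ x y (a ∷ b ∷ r) e with adjacentᵇ⁻ x y (b ∷ r)
... | ih with a ≡ᵇ x in e1 | b ≡ᵇ y in e2
...   | true | true rewrite ≡ᵇ-true⇒≡ {a} {x} e1 | ≡ᵇ-true⇒≡ {b} {y} e2 = [] , r , refl
...   | true | false with ih e
...     | pre , post , eq = a ∷ pre , post , cong (a ∷_) eq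
adjacentᵇ⁻ x y (a ∷ b ∷ r) e | ih | false | _ with ih e
...     | pre , post , eq = a ∷ pre , post , cong (a ∷_) eq

adjacentᵇ⁺ : ∀ x y pre post → adjacentᵇ x y (pre ++ x ∷ y ∷ post) ≡ true
adjacentᵇ⁺ x y [] post rewrite ≡ᵇ-refl x | ≡ᵇ-refl y = refl
adjacentᵇ⁺ x y (a ∷ []) post rewrite adjacentᵇ⁺ x y [] post = ∨-trueʳ _
adjacentᵇ⁺ x y (a ∷ b ∷ pre) post rewrite adjacentᵇ⁺ x y (b ∷ pre) post = ∨-trueʳ _

¬adjacentᵇ : ∀ x y σ → adjacentᵇ x y σ ≡ false → AllAdjacent (λ a b → ¬ (a ≡ x × b ≡ y)) σ
¬adjacentᵇ x y [] e = tt
¬adjacentᵇ x y (a ∷ []) e = tt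
¬adjacentᵇ x y (a ∷ b ∷ r) e with ¬adjacentᵇ x y (b ∷ r)
... | ih with a ≡ᵇ x in e1 | b ≡ᵇ y in e2
...   | true | false = (λ (_ , q) → ≡ᵇ-false⇒≢ e2 q) , ih e
...   | false | _ = (λ (p , _) → ≡ᵇ-false⇒≢ e1 p) , ih e
...   | true | true with e
...     | ()

adjacentᵇ-map⁻ : ∀ (f g : ℕ → ℕ) → (∀ z → g (f z) ≡ z) → ∀ x y σ →
  adjacentᵇ x y (map f σ) ≡ true → adjacentᵇ (g x) (g y) σ ≡ true
adjacentᵇ-map⁻ f g inv x y σ e with adjacentᵇ⁻ x y (map f σ) e
... | pre , post , eq = subst (λ l → adjacentᵇ (g x) (g y) l ≡ true) map-g-fσ
  (adjacentᵇ⁺ (g x) (g y) (map g pre) (map g post))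
  where
  map-g-fσ : map g pre ++ g x ∷ g y ∷ map g post ≡ σ
  map-g-fσ = trans (sym (List.map-++ g pre (x ∷ y ∷ post)))
               (trans (cong (map g) (sym eq)) (map-inverse f g σ (λ z _ → inv z)))

adjacentᵇ-asym : ∀ x y σ → AtMostOnce σ → adjacentᵇ x y σ ≡ true → adjacentᵇ y x σ ≡ false
adjacentᵇ-asym x y σ u xy with adjacentᵇ y x σ in yx
... | false = refl
... | true with adjacentᵇ⁻ x y σ xy | adjacentᵇ⁻ y x σ yx
...   | P , Q , eq₁ | P′ , Q′ , eq₂
  with occ≤1⇒split-unique x P (y ∷ Q) (P′ ++ y ∷ []) Q′ (subst (λ l → occ x l ≤ 1) eq₁ (u x))
         (trans (sym eq₁) (trans eq₂ (sym (++-assoc P′ (y ∷ []) (x ∷ Q′)))))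
...     | _ , y∷Q≡Q′ = ⊥-elim (proj₂ (occ≤1⇒∉-around y P′ (x ∷ Q′) (subst (λ l → occ y l ≤ 1) eq₂ (u y)))
                         (subst (y ∈_) (cong (x ∷_) y∷Q≡Q′) (there (here refl))))

adjacentᵇ-reverse : ∀ x y σ → adjacentᵇ x y σ ≡ true → adjacentᵇ y x (reverse σ) ≡ true
adjacentᵇ-reverse x y σ e with adjacentᵇ⁻ x y σ e
... | P , Q , refl = subst (λ l → adjacentᵇ y x l ≡ true) (sym reverse-shape) (adjacentᵇ⁺ y x (reverse Q) (reverse P))
  where
  reverse-shape : reverse (P ++ x ∷ y ∷ Q) ≡ reverse Q ++ y ∷ x ∷ reverse P
  reverse-shape = trans (List.reverse-++ P (x ∷ y ∷ Q))
    (trans (cong (_++ reverse P) (reverse-∷∷ x y Q)) (++-assoc (reverse Q) (y ∷ x ∷ []) (reverse P)))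

Pin-not-before-larger : ∀ {x y} σ → AtMostOnce σ → x ∈ Pin σ → x < y → adjacentᵇ x y σ ≡ false
Pin-not-before-larger {x} {y} σ u x∈ x<y with adjacentᵇ x y σ in e
... | false = refl
... | true with adjacentᵇ⁻ x y σ e
...   | pre , post , σ≡ with Pin-neighbours σ pre (y ∷ post) u x∈ σ≡
...     | _ , _ , _ , _ , _ , refl , _ , y<x = ⊥-elim (<-asym x<y y<x)

Pin-not-after-larger : ∀ {x y} σ → AtMostOnce σ → x ∈ Pin σ → x < y → adjacentᵇ y x σ ≡ false
Pin-not-after-larger {x} {y} σ u x∈ x<y with adjacentᵇ y x σ in e
... | false = refl
... | true with adjacentᵇ⁻ y x σ e
...   | pre , post , σ≡ with Pin-neighbours σ (pre ++ y ∷ []) post u x∈ (trans σ≡ (sym (++-assoc pre (y ∷ []) (x ∷ post))))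
...     | _ , _ , _ , _ , pre≡ , _ , a<x , _ = ⊥-elim (<-asym x<y (subst (_< x) (sym (proj₂ (∷ʳ-injective pre _ pre≡))) a<x))

-- The letter preceding x, where 0 stands for "none" (letters of permutations are positive).
prevOf : ℕ → List ℕ → ℕ
prevOf x (a ∷ b ∷ r) = if b ≡ᵇ x then a else prevOf x (b ∷ r)
prevOf x _ = 0

prevOf-head : ∀ x a r → x ∉ r → prevOf x (a ∷ r) ≡ 0
prevOf-head x a [] _ = refl
prevOf-head x a (b ∷ r) x∉ with prevOf-head x b r (λ p → x∉ (there p))
... | ih rewrite ≢⇒≡ᵇ-false {b} {x} (λ e → x∉ (here (sym e))) = ih

prevOf-once : ∀ x pre a post → x ∉ pre → x ≢ a → prevOf x (pre ++ a ∷ x ∷ post) ≡ a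
prevOf-once x [] a post _ _ rewrite ≡ᵇ-refl x = refl
prevOf-once x (z ∷ []) a post _ x≢a rewrite ≢⇒≡ᵇ-false {a} {x} (≢-sym x≢a) = prevOf-once x [] a post (λ ()) x≢a
prevOf-once x (z ∷ w ∷ pre) a post x∉ x≢a with prevOf-once x (w ∷ pre) a post (λ p → x∉ (there p)) x≢a
... | ih rewrite ≢⇒≡ᵇ-false {w} {x} (λ e → x∉ (there (here (sym e)))) = ih

subsetᵇ⇒⊆ : ∀ A B → subsetᵇ A B ≡ true → ∀ x → x ∈ A → x ∈ B
subsetᵇ⇒⊆ (a ∷ A) B e x x∈ with a ∈? B
subsetᵇ⇒⊆ (a ∷ A) B e x (here refl) | yes p = p
subsetᵇ⇒⊆ (a ∷ A) B e x (there x∈) | yes p = subsetᵇ⇒⊆ A B e x x∈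
subsetᵇ⇒⊆ (a ∷ A) B () x x∈ | no _

⊆⇒subsetᵇ : ∀ A B → (∀ x → x ∈ A → x ∈ B) → subsetᵇ A B ≡ true
⊆⇒subsetᵇ [] B h = refl
⊆⇒subsetᵇ (a ∷ A) B h with a ∈? B
... | yes p = ⊆⇒subsetᵇ A B (λ x x∈ → h x (there x∈))
... | no np = ⊥-elim (np (h a (here refl)))

hasPinᵇ : List ℕ → List ℕ → Bool
hasPinᵇ X σ = sameSetᵇ (Pin σ) X

hasPinᵇ⁻ : ∀ X σ → hasPinᵇ X σ ≡ true → SameSet (Pin σ) X
hasPinᵇ⁻ X σ e x =
  mk⇔ (subsetᵇ⇒⊆ (Pin σ) X (∧-trueˡ e) x) (subsetᵇ⇒⊆ X (Pin σ) (∧-trueʳ {subsetᵇ (Pin σ) X} e) x)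

hasPinᵇ⁺ : ∀ X σ → SameSet (Pin σ) X → hasPinᵇ X σ ≡ true
hasPinᵇ⁺ X σ h = ∧-true⁺ (⊆⇒subsetᵇ (Pin σ) X (λ x → to (h x))) (⊆⇒subsetᵇ X (Pin σ) (λ x → from (h x)))

p≡count : ∀ k X → p k X ≡ count (hasPinᵇ X) (perms k)
p≡count k X = length-filter (perms k)
  where
  length-filter : ∀ σs → length (filter (λ σ → hasPinᵇ X σ Data.Bool.≟ true) σs) ≡ count (hasPinᵇ X) σs
  length-filter [] = refl
  length-filter (σ ∷ σs) with hasPinᵇ X σ
  ... | true = cong suc (length-filter σs)
  ... | false = length-filter σs

relabel-SameSet : (h : ℕ → ℕ) → (∀ {a b} → h a ≡ h b → a ≡ b) → (E : ℕ → Set) → (X Y PT PS : List ℕ) →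
  (∀ x → x ∈ PS ⇔ ((∃ λ y → y ∈ PT × x ≡ h y) ⊎ E x)) →
  (∀ y → y ∈ Y ⇔ h y ∈ X) → (∀ y → ¬ E (h y)) → (∀ x → E x → x ∈ X) →
  (∀ x → x ∈ X → E x ⊎ (∃ λ y → x ≡ h y)) →
  SameSet PT Y ⇔ SameSet PS X
relabel-SameSet h h-inj E X Y PT PS PS≈ Y≈ E∉im E⊆X X⊆ = mk⇔ forward backward
  where
  forward : SameSet PT Y → SameSet PS X
  forward PT≈Y x = mk⇔ ⊆X ⊆PS
    where
    ⊆X : x ∈ PS → x ∈ X
    ⊆X x∈ with to (PS≈ x) x∈
    ... | inj₁ (y , y∈ , refl) = to (Y≈ y) (to (PT≈Y y) y∈)
    ... | inj₂ ex = E⊆X x ex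
    ⊆PS : x ∈ X → x ∈ PS
    ⊆PS x∈ with X⊆ x x∈
    ... | inj₁ ex = from (PS≈ x) (inj₂ ex)
    ... | inj₂ (y , refl) = from (PS≈ x) (inj₁ (y , from (PT≈Y y) (from (Y≈ y) x∈) , refl))
  backward : SameSet PS X → SameSet PT Y
  backward PS≈X y = mk⇔ ⊆Y ⊆PT
    where
    ⊆Y : y ∈ PT → y ∈ Y
    ⊆Y y∈ = from (Y≈ y) (to (PS≈X (h y)) (from (PS≈ (h y)) (inj₁ (y , y∈ , refl))))
    ⊆PT : y ∈ Y → y ∈ PT
    ⊆PT y∈ with to (PS≈ (h y)) (from (PS≈X (h y)) (to (Y≈ y) y∈))
    ... | inj₁ (y' , y'∈ , e) = subst (_∈ PT) (sym (h-inj e)) y'∈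
    ... | inj₂ ex = ⊥-elim (E∉im y ex)

insertAfter : ℕ → List ℕ → List ℕ → List ℕ
insertAfter v B [] = []
insertAfter v B (z ∷ L) = if v ≡ᵇ z then z ∷ (B ++ insertAfter v B L) else z ∷ insertAfter v B L

insertBefore : ℕ → List ℕ → List ℕ → List ℕ
insertBefore v B [] = []
insertBefore v B (z ∷ L) = if v ≡ᵇ z then B ++ (z ∷ insertBefore v B L) else z ∷ insertBefore v B L

insertAfter-∉ : ∀ v B L → v ∉ L → insertAfter v B L ≡ L
insertAfter-∉ v B [] _ = refl
insertAfter-∉ v B (z ∷ L) v∉ rewrite ≢⇒≡ᵇ-false {v} {z} (λ e → v∉ (here e)) =
  cong (z ∷_) (insertAfter-∉ v B L (λ p → v∉ (there p)))

insertAfter-once : ∀ v B pre post → v ∉ pre → v ∉ post → insertAfter v B (pre ++ v ∷ post) ≡ pre ++ v ∷ B ++ post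
insertAfter-once v B [] post _ v∉ rewrite ≡ᵇ-refl v = cong (λ l → v ∷ B ++ l) (insertAfter-∉ v B post v∉)
insertAfter-once v B (z ∷ pre) post v∉pre v∉post rewrite ≢⇒≡ᵇ-false {v} {z} (λ e → v∉pre (here e)) =
  cong (z ∷_) (insertAfter-once v B pre post (λ p → v∉pre (there p)) v∉post)

insertBefore-∉ : ∀ v B L → v ∉ L → insertBefore v B L ≡ L
insertBefore-∉ v B [] _ = refl
insertBefore-∉ v B (z ∷ L) v∉ rewrite ≢⇒≡ᵇ-false {v} {z} (λ e → v∉ (here e)) =
  cong (z ∷_) (insertBefore-∉ v B L (λ p → v∉ (there p)))

insertBefore-once : ∀ v B pre post → v ∉ pre → v ∉ post → insertBefore v B (pre ++ v ∷ post) ≡ pre ++ B ++ v ∷ post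
insertBefore-once v B [] post _ v∉ rewrite ≡ᵇ-refl v = cong (λ l → B ++ v ∷ l) (insertBefore-∉ v B post v∉)
insertBefore-once v B (z ∷ pre) post v∉pre v∉post rewrite ≢⇒≡ᵇ-false {v} {z} (λ e → v∉pre (here e)) =
  cong (z ∷_) (insertBefore-once v B pre post (λ p → v∉pre (there p)) v∉post)

deleteᵇ : (ℕ → Bool) → List ℕ → List ℕ
deleteᵇ q [] = []
deleteᵇ q (z ∷ L) = if q z then deleteᵇ q L else z ∷ deleteᵇ q L

deleteᵇ-++ : ∀ q A B → deleteᵇ q (A ++ B) ≡ deleteᵇ q A ++ deleteᵇ q B
deleteᵇ-++ q [] B = refl
deleteᵇ-++ q (z ∷ A) B with q z
... | true = deleteᵇ-++ q A B
... | false = cong (z ∷_) (deleteᵇ-++ q A B)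

deleteᵇ-none : ∀ q L → (∀ z → z ∈ L → q z ≡ false) → deleteᵇ q L ≡ L
deleteᵇ-none q [] h = refl
deleteᵇ-none q (z ∷ L) h rewrite h z (here refl) = cong (z ∷_) (deleteᵇ-none q L (λ w p → h w (there p)))

deleteᵇ-all : ∀ q B → (∀ z → z ∈ B → q z ≡ true) → deleteᵇ q B ≡ []
deleteᵇ-all q [] h = refl
deleteᵇ-all q (w ∷ B) h rewrite h w (here refl) = deleteᵇ-all q B (λ u p → h u (there p))

deleteᵇ-middle : ∀ q X B Y → (∀ z → z ∈ X ++ Y → q z ≡ false) → (∀ z → z ∈ B → q z ≡ true) →
  deleteᵇ q (X ++ B ++ Y) ≡ X ++ Y
deleteᵇ-middle q X B Y kept deleted = begin
  deleteᵇ q (X ++ B ++ Y)                          ≡⟨ deleteᵇ-++ q X (B ++ Y) ⟩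
  deleteᵇ q X ++ deleteᵇ q (B ++ Y)                ≡⟨ cong (deleteᵇ q X ++_) (deleteᵇ-++ q B Y) ⟩
  deleteᵇ q X ++ deleteᵇ q B ++ deleteᵇ q Y        ≡⟨ cong (λ l → deleteᵇ q X ++ l ++ deleteᵇ q Y) (deleteᵇ-all q B deleted) ⟩
  deleteᵇ q X ++ deleteᵇ q Y                       ≡⟨ sym (deleteᵇ-++ q X Y) ⟩
  deleteᵇ q (X ++ Y)                               ≡⟨ deleteᵇ-none q (X ++ Y) kept ⟩
  X ++ Y                                           ∎
  where open ≡-Reasoning

-- Deleting the block B of values marked by `deleted` from a permutation of [N] and relabelling
-- the remaining values by unh gives a permutation of [k]; h is the inverse relabelling.
module Relabelling (h unh : ℕ → ℕ) (deleted : ℕ → Bool) (B : List ℕ) (k N : ℕ)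
  (unh-h : ∀ y → unh (h y) ≡ y)
  (h-unh : ∀ x → deleted x ≡ false → h (unh x) ≡ x)
  (h-kept : ∀ y → deleted (h y) ≡ false)
  (B-deleted : ∀ z → z ∈ B → deleted z ≡ true)
  (occ-[N]-h : ∀ y → occ (h y) [ N ] ≡ occ y [ k ])
  (occ-[N]-deleted : ∀ x → deleted x ≡ true → occ x B ≡ occ x [ N ])
  where

  remove : List ℕ → List ℕ
  remove σ = map unh (deleteᵇ deleted σ)

  h-injective : ∀ {a b} → h a ≡ h b → a ≡ b
  h-injective {a} {b} e = trans (sym (unh-h a)) (trans (cong unh e) (unh-h b))

  image-kept : ∀ τ z → z ∈ map h τ → deleted z ≡ false
  image-kept τ z z∈ with ∈-map⁻ h z∈
  ... | y , _ , refl = h-kept y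

  h∉B : ∀ y → h y ∉ B
  h∉B y hy∈ with trans (sym (B-deleted (h y) hy∈)) (h-kept y)
  ... | ()

  occ-B-h : ∀ y → occ (h y) B ≡ 0
  occ-B-h y = ∉⇒occ≡0 B (h∉B y)

  remove-middle : ∀ X Y τ → map h τ ≡ X ++ Y → remove (X ++ B ++ Y) ≡ τ
  remove-middle X Y τ eq = begin
    map unh (deleteᵇ deleted (X ++ B ++ Y))  ≡⟨ cong (map unh) (deleteᵇ-middle deleted X B Y kept B-deleted) ⟩
    map unh (X ++ Y)                         ≡⟨ cong (map unh) (sym eq) ⟩
    map unh (map h τ)                        ≡⟨ map-inverse h unh τ (λ z _ → unh-h z) ⟩
    τ                                        ∎
    where
    open ≡-Reasoning
    kept : ∀ z → z ∈ X ++ Y → deleted z ≡ false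
    kept z z∈ = image-kept τ z (subst (z ∈_) (sym eq) z∈)

  map-remove-middle : ∀ X Y → (∀ z → z ∈ X ++ Y → deleted z ≡ false) → map h (remove (X ++ B ++ Y)) ≡ X ++ Y
  map-remove-middle X Y kept =
    trans (cong (λ l → map h (map unh l)) (deleteᵇ-middle deleted X B Y kept B-deleted))
      (map-inverse unh h (X ++ Y) (λ z z∈ → h-unh z (kept z z∈)))

  PermOf-insert : ∀ X Y τ → map h τ ≡ X ++ Y → PermOf k τ → PermOf N (X ++ B ++ Y)
  PermOf-insert X Y τ eq P x with deleted x in dx
  ... | false = begin
    occ x (X ++ B ++ Y)             ≡⟨ occ-++-middle x X B Y ⟩
    occ x B + occ x (X ++ Y)        ≡⟨ cong₂ (λ u v → occ u B + occ u v) (sym x≡) (sym eq) ⟩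
    occ (h y) B + occ (h y) (map h τ) ≡⟨ cong₂ _+_ (occ-B-h y) (occ-map-injective h h-injective y τ) ⟩
    occ y τ                         ≡⟨ P y ⟩
    occ y [ k ]                     ≡⟨ sym (occ-[N]-h y) ⟩
    occ (h y) [ N ]                 ≡⟨ cong (λ u → occ u [ N ]) x≡ ⟩
    occ x [ N ]                     ∎
    where
    open ≡-Reasoning
    y : ℕ
    y = unh x
    x≡ : h y ≡ x
    x≡ = h-unh x dx
  ... | true = begin
    occ x (X ++ B ++ Y)             ≡⟨ occ-++-middle x X B Y ⟩
    occ x B + occ x (X ++ Y)        ≡⟨ cong (λ l → occ x B + occ x l) (sym eq) ⟩
    occ x B + occ x (map h τ)       ≡⟨ cong (occ x B +_) (occ-map-∉ h x τ not-image) ⟩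
    occ x B + 0                     ≡⟨ +-identityʳ _ ⟩
    occ x B                         ≡⟨ occ-[N]-deleted x dx ⟩
    occ x [ N ]                     ∎
    where
    open ≡-Reasoning
    not-image : ∀ z → h z ≢ x
    not-image z refl with trans (sym dx) (h-kept z)
    ... | ()

  PermOf-remove : ∀ X Y τ → map h τ ≡ X ++ Y → PermOf N (X ++ B ++ Y) → PermOf k τ
  PermOf-remove X Y τ eq P y = begin
    occ y τ                          ≡⟨ sym (occ-map-injective h h-injective y τ) ⟩
    occ (h y) (map h τ)              ≡⟨ cong (occ (h y)) eq ⟩
    occ (h y) (X ++ Y)               ≡⟨ cong (_+ occ (h y) (X ++ Y)) (sym (occ-B-h y)) ⟩
    occ (h y) B + occ (h y) (X ++ Y) ≡⟨ sym (occ-++-middle (h y) X B Y) ⟩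
    occ (h y) (X ++ B ++ Y)          ≡⟨ P (h y) ⟩
    occ (h y) [ N ]                  ≡⟨ occ-[N]-h y ⟩
    occ y [ k ]                      ∎
    where open ≡-Reasoning

-- The recurrence, for n = m + 2

module Recurrence (T : List ℕ) (t m : ℕ) (T<t : All (_< t) T) (1≤t : 1 ≤ t) (t≤1+m : t ≤ suc m) (1≤m : 1 ≤ m) where

  N : ℕ
  N = suc (suc m)

  S S′ U V : List ℕ
  S = T ++ range (suc t) N
  S′ = T ++ t ∷ range (t + 2) N
  U = T ++ range t (suc m)
  V = T ++ range t m

  t<N : t < N
  t<N = s≤s t≤1+m

  ∈T⇒<t : ∀ {x} → x ∈ T → x < t
  ∈T⇒<t x∈ = All.lookup T<t x∈

  ≥t⇒∉T : ∀ {x} → t ≤ x → x ∉ T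
  ≥t⇒∉T h x∈ = <⇒≱ (∈T⇒<t x∈) h

  ∈-T++range : ∀ x a b → x ∈ T ++ range a b ⇔ (x ∈ T ⊎ (a ≤ x × x ≤ b))
  ∈-T++range x a b = mk⇔ split join
    where
    split : x ∈ T ++ range a b → x ∈ T ⊎ (a ≤ x × x ≤ b)
    split x∈ with ∈-++⁻ T x∈
    ... | inj₁ q = inj₁ q
    ... | inj₂ q = inj₂ (∈-range⁻ a b q)
    join : x ∈ T ⊎ (a ≤ x × x ≤ b) → x ∈ T ++ range a b
    join (inj₁ q) = ∈-++⁺ˡ q
    join (inj₂ (a≤x , x≤b)) = ∈-++⁺ʳ T (∈-range⁺ a b a≤x x≤b)

  ∈-T++range-below : ∀ {x} a b → x < a → x ∈ T ++ range a b ⇔ x ∈ T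
  ∈-T++range-below {x} a b x<a = mk⇔ (λ x∈ → [ (λ q → q) , (λ (a≤x , _) → ⊥-elim (<⇒≱ x<a a≤x)) ]′ (to (∈-T++range x a b) x∈))
                                     (λ q → from (∈-T++range x a b) (inj₁ q))

  ∈-T++range-above : ∀ {x} a b → t ≤ x → x ∈ T ++ range a b ⇔ (a ≤ x × x ≤ b)
  ∈-T++range-above {x} a b t≤x = mk⇔ (λ x∈ → [ (λ q → ⊥-elim (≥t⇒∉T t≤x q)) , (λ r → r) ]′ (to (∈-T++range x a b) x∈))
                                     (λ r → from (∈-T++range x a b) (inj₂ r))

  t+1∈S : suc t ∈ S
  t+1∈S = from (∈-T++range (suc t) (suc t) N) (inj₂ (≤-refl , t<N))

  t∉S : t ∉ S
  t∉S t∈ = [ ≥t⇒∉T ≤-refl , (λ (t<t , _) → 1+n≰n t<t) ]′ (to (∈-T++range t (suc t) N) t∈)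

  ∈-S′ : ∀ x → x ∈ S′ ⇔ (x ∈ T ⊎ x ≡ t ⊎ (suc (suc t) ≤ x × x ≤ N))
  ∈-S′ x = mk⇔ split join
    where
    split : x ∈ S′ → x ∈ T ⊎ x ≡ t ⊎ (suc (suc t) ≤ x × x ≤ N)
    split x∈ with ∈-++⁻ T x∈
    ... | inj₁ q = inj₁ q
    ... | inj₂ (here e) = inj₂ (inj₁ e)
    ... | inj₂ (there q) = let (l , u) = ∈-range⁻ (t + 2) N q in inj₂ (inj₂ (subst (_≤ x) (+-comm t 2) l , u))
    join : x ∈ T ⊎ x ≡ t ⊎ (suc (suc t) ≤ x × x ≤ N) → x ∈ S′
    join (inj₁ q) = ∈-++⁺ˡ q
    join (inj₂ (inj₁ e)) = ∈-++⁺ʳ T (here e)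
    join (inj₂ (inj₂ (l , u))) = ∈-++⁺ʳ T (there (∈-range⁺ (t + 2) N (subst (_≤ x) (+-comm 2 t) l) u))

  t∈S′ : t ∈ S′
  t∈S′ = from (∈-S′ t) (inj₂ (inj₁ refl))

  ∈S⇒∈S′ : ∀ {y} → y ≢ suc t → y ∈ S → y ∈ S′
  ∈S⇒∈S′ {y} y≢ y∈ with to (∈-T++range y (suc t) N) y∈
  ... | inj₁ q = from (∈-S′ y) (inj₁ q)
  ... | inj₂ (l , u) with m≤n⇒m<n∨m≡n l
  ...   | inj₁ t+1<y = from (∈-S′ y) (inj₂ (inj₂ (t+1<y , u)))
  ...   | inj₂ e = ⊥-elim (y≢ (sym e))

  ∈S′⇒∈S : ∀ {y} → y ≢ t → y ∈ S′ → y ∈ S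
  ∈S′⇒∈S {y} y≢ y∈ with to (∈-S′ y) y∈
  ... | inj₁ q = from (∈-T++range y (suc t) N) (inj₁ q)
  ... | inj₂ (inj₁ e) = ⊥-elim (y≢ e)
  ... | inj₂ (inj₂ (l , u)) = from (∈-T++range y (suc t) N) (inj₂ (≤-trans (n≤1+n _) l , u))

  ≥t∧≢t⇒≥t+1 : ∀ {x} → t ≤ x → x ≢ t → suc t ≤ x
  ≥t∧≢t⇒≥t+1 t≤x x≢t = ≤∧≢⇒< t≤x (≢-sym x≢t)

  ≥t∧≢⇒≥t+2 : ∀ {x} → t ≤ x → x ≢ t → x ≢ suc t → suc (suc t) ≤ x
  ≥t∧≢⇒≥t+2 t≤x x≢t x≢t+1 = ≤∧≢⇒< (≥t∧≢t⇒≥t+1 t≤x x≢t) (≢-sym x≢t+1)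

  -- shift₂ and shift₁ make room for inserting t, t+1 resp. t.

  shift₂ unshift₂ shift₁ unshift₁ transpose : ℕ → ℕ
  shift₂ x = if x <ᵇ t then x else suc (suc x)
  unshift₂ x = if x <ᵇ t then x else x ∸ 2
  shift₁ x = if x <ᵇ t then x else suc x
  unshift₁ x = if x <ᵇ t then x else x ∸ 1
  transpose x = if x ≡ᵇ t then suc t else (if x ≡ᵇ suc t then t else x)

  module _ {x : ℕ} where
    shift₂-< : x < t → shift₂ x ≡ x
    shift₂-< h rewrite <⇒<ᵇ-true h = refl
    shift₂-≥ : t ≤ x → shift₂ x ≡ suc (suc x)
    shift₂-≥ h rewrite ≮⇒<ᵇ-false (≤⇒≯ h) = refl
    unshift₂-< : x < t → unshift₂ x ≡ x
    unshift₂-< h rewrite <⇒<ᵇ-true h = refl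
    unshift₂-≥ : t ≤ x → unshift₂ x ≡ x ∸ 2
    unshift₂-≥ h rewrite ≮⇒<ᵇ-false (≤⇒≯ h) = refl
    shift₁-< : x < t → shift₁ x ≡ x
    shift₁-< h rewrite <⇒<ᵇ-true h = refl
    shift₁-≥ : t ≤ x → shift₁ x ≡ suc x
    shift₁-≥ h rewrite ≮⇒<ᵇ-false (≤⇒≯ h) = refl
    unshift₁-< : x < t → unshift₁ x ≡ x
    unshift₁-< h rewrite <⇒<ᵇ-true h = refl
    unshift₁-≥ : t ≤ x → unshift₁ x ≡ x ∸ 1
    unshift₁-≥ h rewrite ≮⇒<ᵇ-false (≤⇒≯ h) = refl

  shift₂-mono : ∀ a b → a < b → shift₂ a < shift₂ b
  shift₂-mono a b a<b with a <? t | b <? t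
  ... | yes p | yes q rewrite shift₂-< p | shift₂-< q = a<b
  ... | yes p | no q rewrite shift₂-< p | shift₂-≥ (≮⇒≥ q) = m<n⇒m<1+n (m<n⇒m<1+n a<b)
  ... | no p | yes q = ⊥-elim (p (<-trans a<b q))
  ... | no p | no q rewrite shift₂-≥ (≮⇒≥ p) | shift₂-≥ (≮⇒≥ q) = s≤s (s≤s a<b)

  shift₁-mono : ∀ a b → a < b → shift₁ a < shift₁ b
  shift₁-mono a b a<b with a <? t | b <? t
  ... | yes p | yes q rewrite shift₁-< p | shift₁-< q = a<b
  ... | yes p | no q rewrite shift₁-< p | shift₁-≥ (≮⇒≥ q) = m<n⇒m<1+n a<b
  ... | no p | yes q = ⊥-elim (p (<-trans a<b q))
  ... | no p | no q rewrite shift₁-≥ (≮⇒≥ p) | shift₁-≥ (≮⇒≥ q) = s≤s a<b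

  unshift₂-shift₂ : ∀ y → unshift₂ (shift₂ y) ≡ y
  unshift₂-shift₂ y with y <? t
  ... | yes p rewrite shift₂-< p = unshift₂-< p
  ... | no p rewrite shift₂-≥ (≮⇒≥ p) = unshift₂-≥ (≤-trans (≮⇒≥ p) (≤-trans (n≤1+n y) (n≤1+n _)))

  unshift₁-shift₁ : ∀ y → unshift₁ (shift₁ y) ≡ y
  unshift₁-shift₁ y with y <? t
  ... | yes p rewrite shift₁-< p = unshift₁-< p
  ... | no p rewrite shift₁-≥ (≮⇒≥ p) = unshift₁-≥ (≤-trans (≮⇒≥ p) (n≤1+n y))

  shift₂-unshift₂ : ∀ x → x ≢ t → x ≢ suc t → shift₂ (unshift₂ x) ≡ x
  shift₂-unshift₂ x x≢t x≢t+1 with x <? t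
  ... | yes p rewrite unshift₂-< p = shift₂-< p
  ... | no p rewrite unshift₂-≥ (≮⇒≥ p) = trans (shift₂-≥ t≤x∸2) (m+[n∸m]≡n (≤-trans (s≤s (s≤s z≤n)) t+2≤x))
    where
    t+2≤x : suc (suc t) ≤ x
    t+2≤x = ≥t∧≢⇒≥t+2 (≮⇒≥ p) x≢t x≢t+1
    t≤x∸2 : t ≤ x ∸ 2
    t≤x∸2 = m+n≤o⇒m≤o∸n t (subst (_≤ x) (+-comm 2 t) t+2≤x)

  shift₁-unshift₁ : ∀ x → x ≢ t → shift₁ (unshift₁ x) ≡ x
  shift₁-unshift₁ x x≢t with x <? t
  ... | yes p rewrite unshift₁-< p = shift₁-< p
  ... | no p rewrite unshift₁-≥ (≮⇒≥ p) = trans (shift₁-≥ t≤x∸1) (m+[n∸m]≡n (≤-trans (s≤s z≤n) t+1≤x))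
    where
    t+1≤x : suc t ≤ x
    t+1≤x = ≥t∧≢t⇒≥t+1 (≮⇒≥ p) x≢t
    t≤x∸1 : t ≤ x ∸ 1
    t≤x∸1 = m+n≤o⇒m≤o∸n t (subst (_≤ x) (+-comm 1 t) t+1≤x)

  shift₂≢t : ∀ y → shift₂ y ≢ t
  shift₂≢t y e with y <? t
  ... | yes p = <-irrefl e (subst (_< t) (sym (shift₂-< p)) p)
  ... | no p = <-irrefl (sym e) (subst (t <_) (sym (shift₂-≥ (≮⇒≥ p))) (s≤s (≤-trans (≮⇒≥ p) (n≤1+n y))))

  shift₂≢t+1 : ∀ y → shift₂ y ≢ suc t
  shift₂≢t+1 y e with y <? t
  ... | yes p = <-irrefl e (subst (_< suc t) (sym (shift₂-< p)) (m<n⇒m<1+n p))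
  ... | no p = <-irrefl (sym e) (subst (suc t <_) (sym (shift₂-≥ (≮⇒≥ p))) (s≤s (s≤s (≮⇒≥ p))))

  shift₁≢t : ∀ y → shift₁ y ≢ t
  shift₁≢t y e with y <? t
  ... | yes p = <-irrefl e (subst (_< t) (sym (shift₁-< p)) p)
  ... | no p = <-irrefl (sym e) (subst (t <_) (sym (shift₁-≥ (≮⇒≥ p))) (s≤s (≮⇒≥ p)))

  occ-[N]-shift₂ : ∀ y → occ (shift₂ y) [ N ] ≡ occ y [ m ]
  occ-[N]-shift₂ y with y <? t
  ... | yes p rewrite shift₂-< p = occ-[]-cong y N y m
          (λ (a , _) → a , ≤-pred (≤-trans p t≤1+m)) (λ (a , b) → a , ≤-trans b (≤-trans (n≤1+n m) (n≤1+n _)))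
  ... | no p rewrite shift₂-≥ (≮⇒≥ p) = occ-[]-cong (suc (suc y)) N y m
          (λ (_ , b) → ≤-trans 1≤t (≮⇒≥ p) , ≤-pred (≤-pred b)) (λ (_ , b) → s≤s z≤n , s≤s (s≤s b))

  occ-[N]-shift₁ : ∀ y → occ (shift₁ y) [ N ] ≡ occ y [ suc m ]
  occ-[N]-shift₁ y with y <? t
  ... | yes p rewrite shift₁-< p = occ-[]-cong y N y (suc m)
          (λ (a , _) → a , <⇒≤ (≤-trans p t≤1+m)) (λ (a , b) → a , ≤-trans b (n≤1+n _))
  ... | no p rewrite shift₁-≥ (≮⇒≥ p) = occ-[]-cong (suc y) N y (suc m)
          (λ (_ , b) → ≤-trans 1≤t (≮⇒≥ p) , ≤-pred b) (λ (_ , b) → s≤s z≤n , s≤s b)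

  occ-[N]-t : occ t [ N ] ≡ 1
  occ-[N]-t = occ-[]-in N 1≤t (<⇒≤ t<N)

  occ-[N]-t+1 : occ (suc t) [ N ] ≡ 1
  occ-[N]-t+1 = occ-[]-in N (s≤s z≤n) t<N

  transpose-t : transpose t ≡ suc t
  transpose-t rewrite ≡ᵇ-refl t = refl

  transpose-t+1 : transpose (suc t) ≡ t
  transpose-t+1 rewrite ≢⇒≡ᵇ-false {suc t} {t} 1+n≢n | ≡ᵇ-refl (suc t) = refl

  transpose-other : ∀ {x} → x ≢ t → x ≢ suc t → transpose x ≡ x
  transpose-other x≢t x≢t+1 rewrite ≢⇒≡ᵇ-false x≢t | ≢⇒≡ᵇ-false x≢t+1 = refl

  transpose-involutive : ∀ x → transpose (transpose x) ≡ x
  transpose-involutive x with x ≟ t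
  ... | yes refl rewrite transpose-t = transpose-t+1
  ... | no x≢t with x ≟ suc t
  ...   | yes refl rewrite transpose-t+1 = transpose-t
  ...   | no x≢t+1 rewrite transpose-other x≢t x≢t+1 = transpose-other x≢t x≢t+1

  transpose-injective : ∀ {a b} → transpose a ≡ transpose b → a ≡ b
  transpose-injective {a} {b} e =
    trans (sym (transpose-involutive a)) (trans (cong transpose e) (transpose-involutive b))

  occ-[N]-transpose : ∀ x → occ (transpose x) [ N ] ≡ occ x [ N ]
  occ-[N]-transpose x with x ≟ t
  ... | yes refl rewrite transpose-t = trans occ-[N]-t+1 (sym occ-[N]-t)
  ... | no x≢t with x ≟ suc t
  ...   | yes refl rewrite transpose-t+1 = trans occ-[N]-t (sym occ-[N]-t+1)
  ...   | no x≢t+1 rewrite transpose-other x≢t x≢t+1 = refl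

  -- Since t and t+1 are consecutive, transpose preserves every comparison except the one between them.
  transpose-< : ∀ u v → ¬ (u ≡ t × v ≡ suc t) → u < v → transpose u < transpose v
  transpose-< u v not-t,t+1 u<v with u ≟ t | u ≟ suc t | v ≟ t | v ≟ suc t
  ... | yes refl | _ | _ | yes refl = ⊥-elim (not-t,t+1 (refl , refl))
  ... | yes refl | _ | yes refl | _ = ⊥-elim (<-irrefl refl u<v)
  ... | yes refl | _ | no v≢t | no v≢t+1 rewrite transpose-t | transpose-other v≢t v≢t+1 =
    ≤∧≢⇒< u<v (≢-sym v≢t+1)
  ... | no _ | yes refl | yes refl | _ = ⊥-elim (<-asym u<v (n<1+n t))
  ... | no _ | yes refl | _ | yes refl = ⊥-elim (<-irrefl refl u<v)
  ... | no _ | yes refl | no v≢t | no v≢t+1 rewrite transpose-t+1 | transpose-other v≢t v≢t+1 =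
    <-trans (n<1+n t) u<v
  ... | no u≢t | no u≢t+1 | yes refl | _ rewrite transpose-other u≢t u≢t+1 | transpose-t = m<n⇒m<1+n u<v
  ... | no u≢t | no u≢t+1 | no _ | yes refl rewrite transpose-other u≢t u≢t+1 | transpose-t+1 =
    ≤∧≢⇒< (≤-pred u<v) u≢t
  ... | no u≢t | no u≢t+1 | no v≢t | no v≢t+1 rewrite transpose-other u≢t u≢t+1 | transpose-other v≢t v≢t+1 = u<v

  transpose-preservesOrder : ∀ a b → ¬ (a ≡ t × b ≡ suc t) → ¬ (a ≡ suc t × b ≡ t) → PreservesOrder transpose a b
  transpose-preservesOrder a b not-t,t+1 not-t+1,t = agree a b not-t,t+1 not-t+1,t , agree b a not-t+1,t′ not-t,t+1′
    where
    not-t+1,t′ : ¬ (b ≡ t × a ≡ suc t)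
    not-t+1,t′ (x , y) = not-t+1,t (y , x)
    not-t,t+1′ : ¬ (b ≡ suc t × a ≡ t)
    not-t,t+1′ (x , y) = not-t,t+1 (y , x)
    reflect : ∀ u v → ¬ (u ≡ suc t × v ≡ t) → transpose u < transpose v → u < v
    reflect u v not-t+1,t tu<tv = subst₂ _<_ (transpose-involutive u) (transpose-involutive v)
      (transpose-< (transpose u) (transpose v)
        (λ (x , y) → not-t+1,t (transpose-injective (trans x (sym transpose-t+1)) ,
                                transpose-injective (trans y (sym transpose-t))))
        tu<tv)
    agree : ∀ u v → ¬ (u ≡ t × v ≡ suc t) → ¬ (u ≡ suc t × v ≡ t) → (u <ᵇ v) ≡ (transpose u <ᵇ transpose v)
    agree u v c1 c2 with u <? v
    ... | yes u<v = trans (<⇒<ᵇ-true u<v) (sym (<⇒<ᵇ-true (transpose-< u v c1 u<v)))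
    ... | no u≮v = trans (≮⇒<ᵇ-false u≮v) (sym (≮⇒<ᵇ-false (λ tu<tv → u≮v (reflect u v c2 tu<tv))))

  ∈V⇔shift₂∈S : ∀ y → y ∈ V ⇔ shift₂ y ∈ S
  ∈V⇔shift₂∈S y with y <? t
  ... | yes y<t rewrite shift₂-< y<t =
    mk⇔ (λ q → from (∈-T++range-below (suc t) N (m<n⇒m<1+n y<t)) (to (∈-T++range-below t m y<t) q))
        (λ q → from (∈-T++range-below t m y<t) (to (∈-T++range-below (suc t) N (m<n⇒m<1+n y<t)) q))
  ... | no y≮t rewrite shift₂-≥ (≮⇒≥ y≮t) =
    mk⇔ (λ q → let (l , u) = to (∈-T++range-above t m t≤y) q in
               from (∈-T++range-above (suc t) N t≤y+2) (s≤s (≤-trans l (n≤1+n _)) , s≤s (s≤s u)))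
        (λ q → let (_ , u) = to (∈-T++range-above (suc t) N t≤y+2) q in
               from (∈-T++range-above t m t≤y) (t≤y , ≤-pred (≤-pred u)))
    where
    t≤y : t ≤ y
    t≤y = ≮⇒≥ y≮t
    t≤y+2 : t ≤ suc (suc y)
    t≤y+2 = ≤-trans t≤y (≤-trans (n≤1+n _) (n≤1+n _))

  ∈S⇒t+1∨shift₂ : ∀ x → x ∈ S → x ≡ suc t ⊎ (∃ λ y → x ≡ shift₂ y)
  ∈S⇒t+1∨shift₂ x x∈ with to (∈-T++range x (suc t) N) x∈
  ... | inj₁ q = inj₂ (x , sym (shift₂-< (∈T⇒<t q)))
  ... | inj₂ (t+1≤x , _) with x ≟ suc t
  ...   | yes x≡t+1 = inj₁ x≡t+1
  ...   | no x≢t+1 = inj₂ (unshift₂ x , sym (shift₂-unshift₂ x (λ e → <⇒≢ t+1≤x (sym e)) x≢t+1))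

  ∈U⇔shift₁∈S : ∀ y → y ∈ U ⇔ shift₁ y ∈ S
  ∈U⇔shift₁∈S y with y <? t
  ... | yes y<t rewrite shift₁-< y<t =
    mk⇔ (λ q → from (∈-T++range-below (suc t) N (m<n⇒m<1+n y<t)) (to (∈-T++range-below t (suc m) y<t) q))
        (λ q → from (∈-T++range-below t (suc m) y<t) (to (∈-T++range-below (suc t) N (m<n⇒m<1+n y<t)) q))
  ... | no y≮t rewrite shift₁-≥ (≮⇒≥ y≮t) =
    mk⇔ (λ q → let (l , u) = to (∈-T++range-above t (suc m) t≤y) q in
               from (∈-T++range-above (suc t) N t≤y+1) (s≤s l , s≤s u))
        (λ q → let (_ , u) = to (∈-T++range-above (suc t) N t≤y+1) q in
               from (∈-T++range-above t (suc m) t≤y) (t≤y , ≤-pred u))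
    where
    t≤y : t ≤ y
    t≤y = ≮⇒≥ y≮t
    t≤y+1 : t ≤ suc y
    t≤y+1 = ≤-trans t≤y (n≤1+n _)

  ∈S⇒shift₁ : ∀ x → x ∈ S → ⊥ ⊎ (∃ λ y → x ≡ shift₁ y)
  ∈S⇒shift₁ x x∈ = inj₂ (unshift₁ x , sym (shift₁-unshift₁ x (λ { refl → t∉S x∈ })))

  ∈S⇔transpose∈S′ : ∀ y → y ∈ S ⇔ transpose y ∈ S′
  ∈S⇔transpose∈S′ y with y ≟ t
  ... | yes refl rewrite transpose-t =
    mk⇔ (λ t∈ → ⊥-elim (t∉S t∈)) (λ t+1∈ → ⊥-elim (t+1∉S′ t+1∈))
    where
    t+1∉S′ : suc t ∉ S′
    t+1∉S′ q with to (∈-S′ (suc t)) q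
    ... | inj₁ q′ = ≥t⇒∉T (n≤1+n t) q′
    ... | inj₂ (inj₁ e) = 1+n≢n e
    ... | inj₂ (inj₂ (l , _)) = 1+n≰n l
  ... | no y≢t with y ≟ suc t
  ...   | yes refl rewrite transpose-t+1 = mk⇔ (λ _ → t∈S′) (λ _ → t+1∈S)
  ...   | no y≢t+1 rewrite transpose-other y≢t y≢t+1 = mk⇔ (∈S⇒∈S′ y≢t+1) (∈S′⇒∈S y≢t)

  isT isT∨T+1 : ℕ → Bool
  isT z = z ≡ᵇ t
  isT∨T+1 z = (z ≡ᵇ t) ∨ (z ≡ᵇ suc t)

  isT∨T+1-false : ∀ {z} → z ≢ t → z ≢ suc t → isT∨T+1 z ≡ false
  isT∨T+1-false z≢t z≢t+1 rewrite ≢⇒≡ᵇ-false z≢t | ≢⇒≡ᵇ-false z≢t+1 = refl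

  isT∨T+1-false⁻ : ∀ {z} → isT∨T+1 z ≡ false → z ≢ t × z ≢ suc t
  isT∨T+1-false⁻ e = ≡ᵇ-false⇒≢ (∨-falseˡ e) , ≡ᵇ-false⇒≢ (∨-falseʳ e)

  isT∨T+1-true : ∀ {z} → isT∨T+1 z ≡ true → z ≡ t ⊎ z ≡ suc t
  isT∨T+1-true {z} e with z ≡ᵇ t in e1
  ... | true = inj₁ (≡ᵇ-true⇒≡ e1)
  ... | false = inj₂ (≡ᵇ-true⇒≡ e)

  isT∨T+1-t : isT∨T+1 t ≡ true
  isT∨T+1-t rewrite ≡ᵇ-refl t = refl

  isT∨T+1-t+1 : isT∨T+1 (suc t) ≡ true
  isT∨T+1-t+1 rewrite ≡ᵇ-refl (suc t) = ∨-trueʳ _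

  occ-t,t+1 : ∀ x → isT∨T+1 x ≡ true → occ x (t ∷ suc t ∷ []) ≡ occ x [ N ]
  occ-t,t+1 x d with isT∨T+1-true {x} d
  ... | inj₁ refl = trans (trans (occ-here t (suc t ∷ [])) (cong suc (occ-ne {t} {suc t} [] (≢-sym 1+n≢n)))) (sym occ-[N]-t)
  ... | inj₂ refl = trans (trans (occ-ne {suc t} {t} (suc t ∷ []) 1+n≢n) (occ-here (suc t) [])) (sym occ-[N]-t+1)

  occ-t : ∀ x → isT x ≡ true → occ x (t ∷ []) ≡ occ x [ N ]
  occ-t x d rewrite ≡ᵇ-true⇒≡ {x} d = trans (occ-here t []) (sym occ-[N]-t)

  shift₂-unshift₂-kept : ∀ x → isT∨T+1 x ≡ false → shift₂ (unshift₂ x) ≡ x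
  shift₂-unshift₂-kept x kept = shift₂-unshift₂ x (proj₁ (isT∨T+1-false⁻ kept)) (proj₂ (isT∨T+1-false⁻ kept))

  isT∨T+1-shift₂ : ∀ y → isT∨T+1 (shift₂ y) ≡ false
  isT∨T+1-shift₂ y = isT∨T+1-false (shift₂≢t y) (shift₂≢t+1 y)

  t,t+1-deleted : ∀ z → z ∈ t ∷ suc t ∷ [] → isT∨T+1 z ≡ true
  t,t+1-deleted z (here refl) = isT∨T+1-t
  t,t+1-deleted z (there (here refl)) = isT∨T+1-t+1

  shift₁-unshift₁-kept : ∀ x → isT x ≡ false → shift₁ (unshift₁ x) ≡ x
  shift₁-unshift₁-kept x kept = shift₁-unshift₁ x (≡ᵇ-false⇒≢ kept)

  isT-shift₁ : ∀ y → isT (shift₁ y) ≡ false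
  isT-shift₁ y = ≢⇒≡ᵇ-false (shift₁≢t y)

  t-deleted : ∀ z → z ∈ t ∷ [] → isT z ≡ true
  t-deleted z (here refl) = ≡ᵇ-refl t

  module Remove₂ = Relabelling shift₂ unshift₂ isT∨T+1 (t ∷ suc t ∷ []) m N
    unshift₂-shift₂ shift₂-unshift₂-kept isT∨T+1-shift₂ t,t+1-deleted occ-[N]-shift₂ occ-t,t+1

  module Remove₁ = Relabelling shift₁ unshift₁ isT (t ∷ []) (suc m) N
    unshift₁-shift₁ shift₁-unshift₁-kept isT-shift₁ t-deleted occ-[N]-shift₁ occ-t

  Pin-shift₂ : ∀ τ → Pin (map shift₂ τ) ≡ map shift₂ (Pin τ)
  Pin-shift₂ τ = Pin-map shift₂ τ (AllAdjacent-universal τ (strictMono⇒PreservesOrder shift₂ shift₂-mono))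

  Pin-shift₁ : ∀ τ → Pin (map shift₁ τ) ≡ map shift₁ (Pin τ)
  Pin-shift₁ τ = Pin-map shift₁ τ (AllAdjacent-universal τ (strictMono⇒PreservesOrder shift₁ shift₁-mono))

  up down : List ℕ → Bool
  up = adjacentᵇ t (suc t)
  down = adjacentᵇ (suc t) t

  Apart WithUp WithDown : List ℕ → Bool
  Apart σ = (hasPinᵇ S σ ∧ not (up σ)) ∧ not (down σ)
  WithUp σ = hasPinᵇ S σ ∧ up σ
  WithDown σ = hasPinᵇ S σ ∧ down σ

  count-S-by-adjacency : count (hasPinᵇ S) (perms N) ≡ count WithUp (perms N) + (count WithDown (perms N) + count Apart (perms N))
  count-S-by-adjacency = begin
    count (hasPinᵇ S) (perms N)
      ≡⟨ count-split (hasPinᵇ S) up (perms N) ⟩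
    count WithUp (perms N) + count (λ σ → hasPinᵇ S σ ∧ not (up σ)) (perms N)
      ≡⟨ cong (count WithUp (perms N) +_) (count-split (λ σ → hasPinᵇ S σ ∧ not (up σ)) down (perms N)) ⟩
    count WithUp (perms N) + (count (λ σ → (hasPinᵇ S σ ∧ not (up σ)) ∧ down σ) (perms N) + count Apart (perms N))
      ≡⟨ cong (λ c → count WithUp (perms N) + (c + count Apart (perms N))) (count-cong _ _ (perms N) down⇒¬up) ⟩
    count WithUp (perms N) + (count WithDown (perms N) + count Apart (perms N)) ∎
    where
    open ≡-Reasoning
    drop-not : ∀ g a b → (b ≡ true → a ≡ false) → ((g ∧ not a) ∧ b) ≡ (g ∧ b)
    drop-not g a true h rewrite h refl = cong (_∧ true) (∧-identityʳ g)
    drop-not g a false h = trans (∧-zeroʳ _) (sym (∧-zeroʳ g))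
    down⇒¬up : ∀ σ → σ ∈ perms N → ((hasPinᵇ S σ ∧ not (up σ)) ∧ down σ) ≡ WithDown σ
    down⇒¬up σ σ∈ = drop-not (hasPinᵇ S σ) (up σ) (down σ)
      (adjacentᵇ-asym (suc t) t σ (PermOf⇒AtMostOnce {N} {σ} (perms-sound N σ σ∈)))

  Pin-transpose : ∀ σ → up σ ≡ false → down σ ≡ false → Pin (map transpose σ) ≡ map transpose (Pin σ)
  Pin-transpose σ ¬up ¬down = Pin-map transpose σ
    (AllAdjacent-mono σ (λ a b (c₁ , c₂) → transpose-preservesOrder a b c₁ c₂)
      (AllAdjacent-× σ (¬adjacentᵇ t (suc t) σ ¬up) (¬adjacentᵇ (suc t) t σ ¬down)))

  SameSet-transpose : ∀ σ → up σ ≡ false → down σ ≡ false →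
    SameSet (Pin σ) S ⇔ SameSet (Pin (map transpose σ)) S′
  SameSet-transpose σ ¬up ¬down = relabel-SameSet transpose transpose-injective (λ _ → ⊥) S′ S (Pin σ)
    (Pin (map transpose σ))
    (λ x → mk⇔ (λ x∈ → inj₁ (∈-map⁻ transpose (subst (x ∈_) (Pin-transpose σ ¬up ¬down) x∈)))
               [ (λ { (y , y∈ , refl) → subst (x ∈_) (sym (Pin-transpose σ ¬up ¬down)) (∈-map⁺ transpose y∈) }) , ⊥-elim ]′)
    ∈S⇔transpose∈S′ (λ _ ()) (λ _ ()) (λ x _ → inj₂ (transpose x , sym (transpose-involutive x)))

  PermOf-transpose : ∀ σ → PermOf N σ → PermOf N (map transpose σ)
  PermOf-transpose σ P x = begin
    occ x (map transpose σ)                         ≡⟨ cong (λ z → occ z (map transpose σ)) (sym (transpose-involutive x)) ⟩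
    occ (transpose (transpose x)) (map transpose σ) ≡⟨ occ-map-injective transpose transpose-injective (transpose x) σ ⟩
    occ (transpose x) σ                             ≡⟨ P (transpose x) ⟩
    occ (transpose x) [ N ]                         ≡⟨ occ-[N]-transpose x ⟩
    occ x [ N ]                                     ∎
    where open ≡-Reasoning

  map-transpose-involutive : ∀ σ → map transpose (map transpose σ) ≡ σ
  map-transpose-involutive σ = map-inverse transpose transpose σ (λ z _ → transpose-involutive z)

  -- t is a pinnacle for S′, so it has no neighbour t+1; after the exchange t+1 has no neighbour t.
  transpose-S′⇒apart : ∀ σ → σ ∈ perms N → hasPinᵇ S′ σ ≡ true →
    up σ ≡ false × down σ ≡ false × up (map transpose σ) ≡ false × down (map transpose σ) ≡ false
  transpose-S′⇒apart σ σ∈ pins = ¬up , ¬down , ¬up′ , ¬down′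
    where
    u : AtMostOnce σ
    u = PermOf⇒AtMostOnce {N} {σ} (perms-sound N σ σ∈)
    t∈Pin : t ∈ Pin σ
    t∈Pin = from (hasPinᵇ⁻ S′ σ pins t) t∈S′
    ¬up : up σ ≡ false
    ¬up = Pin-not-before-larger σ u t∈Pin (n<1+n t)
    ¬down : down σ ≡ false
    ¬down = Pin-not-after-larger σ u t∈Pin (n<1+n t)
    pulled-back : ∀ {x y} → adjacentᵇ x y (map transpose σ) ≡ true → adjacentᵇ (transpose x) (transpose y) σ ≡ true
    pulled-back {x} {y} = adjacentᵇ-map⁻ transpose transpose transpose-involutive x y σ
    ¬up′ : up (map transpose σ) ≡ false
    ¬up′ with up (map transpose σ) in e
    ... | false = refl
    ... | true with trans (sym (subst₂ (λ a b → adjacentᵇ a b σ ≡ true) transpose-t transpose-t+1 (pulled-back e))) ¬down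
    ...   | ()
    ¬down′ : down (map transpose σ) ≡ false
    ¬down′ with down (map transpose σ) in e
    ... | false = refl
    ... | true with trans (sym (subst₂ (λ a b → adjacentᵇ a b σ ≡ true) transpose-t+1 transpose-t (pulled-back e))) ¬up
    ...   | ()

  count-Apart : count Apart (perms N) ≡ count (hasPinᵇ S′) (perms N)
  count-Apart = count-bijection Apart (hasPinᵇ S′) (map transpose) (map transpose) (perms N) (perms N)
    (perms-distinct N) (perms-distinct N) forward backward
    where
    forward : ∀ σ → σ ∈ perms N → Apart σ ≡ true →
      map transpose σ ∈ perms N × hasPinᵇ S′ (map transpose σ) ≡ true × map transpose (map transpose σ) ≡ σ
    forward σ σ∈ apart =
      perms-complete N (map transpose σ) (PermOf-transpose σ (perms-sound N σ σ∈)) ,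
      hasPinᵇ⁺ S′ (map transpose σ) (to (SameSet-transpose σ ¬up ¬down) (hasPinᵇ⁻ S σ pins)) ,
      map-transpose-involutive σ
      where
      pins : hasPinᵇ S σ ≡ true
      pins = ∧-trueˡ (∧-trueˡ apart)
      ¬up : up σ ≡ false
      ¬up = not-true⁻ (∧-trueʳ {hasPinᵇ S σ} (∧-trueˡ apart))
      ¬down : down σ ≡ false
      ¬down = not-true⁻ (∧-trueʳ {hasPinᵇ S σ ∧ not (up σ)} apart)
    backward : ∀ σ → σ ∈ perms N → hasPinᵇ S′ σ ≡ true →
      map transpose σ ∈ perms N × Apart (map transpose σ) ≡ true × map transpose (map transpose σ) ≡ σ
    backward σ σ∈ pins with transpose-S′⇒apart σ σ∈ pins
    ... | ¬up , ¬down , ¬up′ , ¬down′ =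
      perms-complete N (map transpose σ) (PermOf-transpose σ (perms-sound N σ σ∈)) ,
      ∧-true⁺ (∧-true⁺ (hasPinᵇ⁺ S (map transpose σ) (from (SameSet-transpose (map transpose σ) ¬up′ ¬down′) pins′))
                       (not-true⁺ ¬up′))
              (not-true⁺ ¬down′) ,
      map-transpose-involutive σ
      where
      pins′ : SameSet (Pin (map transpose (map transpose σ))) S′
      pins′ = subst (λ l → SameSet (Pin l) S′) (sym (map-transpose-involutive σ)) (hasPinᵇ⁻ S′ σ pins)

  count-WithDown : count WithDown (perms N) ≡ count WithUp (perms N)
  count-WithDown = count-bijection WithDown WithUp reverse reverse (perms N) (perms N)
    (perms-distinct N) (perms-distinct N) (reverse-flips (suc t) t) (reverse-flips t (suc t))
    where
    reverse-flips : ∀ x y σ → σ ∈ perms N → (hasPinᵇ S σ ∧ adjacentᵇ x y σ) ≡ true →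
      reverse σ ∈ perms N × (hasPinᵇ S (reverse σ) ∧ adjacentᵇ y x (reverse σ)) ≡ true × reverse (reverse σ) ≡ σ
    reverse-flips x y σ σ∈ e =
      perms-complete N (reverse σ) (λ z → trans (occ-reverse z σ) (perms-sound N σ σ∈ z)) ,
      ∧-true⁺ (hasPinᵇ-reverse (∧-trueˡ e)) (adjacentᵇ-reverse x y σ (∧-trueʳ {hasPinᵇ S σ} e)) ,
      List.reverse-involutive σ
      where
      hasPinᵇ-reverse : hasPinᵇ S σ ≡ true → hasPinᵇ S (reverse σ) ≡ true
      hasPinᵇ-reverse pins = hasPinᵇ⁺ S (reverse σ) λ z →
        mk⇔ (λ z∈ → to (hasPinᵇ⁻ S σ pins z) (Any.reverse⁻ (subst (z ∈_) (Pin-reverse σ) z∈)))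
            (λ z∈ → subst (z ∈_) (sym (Pin-reverse σ)) (Any.reverse⁺ (from (hasPinᵇ⁻ S σ pins z) z∈)))

  SameSet-shift₂ : ∀ τ PS → (∀ x → x ∈ PS ⇔ (x ∈ Pin (map shift₂ τ) ⊎ x ≡ suc t)) →
    SameSet (Pin τ) V ⇔ SameSet PS S
  SameSet-shift₂ τ PS PS≈ = relabel-SameSet shift₂ Remove₂.h-injective (_≡ suc t) S V (Pin τ) PS
    (λ x → mk⇔ (λ x∈ → map₁ (λ q → ∈-map⁻ shift₂ (subst (x ∈_) (Pin-shift₂ τ) q)) (to (PS≈ x) x∈))
               (λ q → from (PS≈ x) (map₁ (λ { (y , y∈ , refl) → subst (_ ∈_) (sym (Pin-shift₂ τ)) (∈-map⁺ shift₂ y∈) }) q)))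
    ∈V⇔shift₂∈S shift₂≢t+1 (λ { x refl → t+1∈S }) ∈S⇒t+1∨shift₂

  SameSet-shift₁ : ∀ τ PS → PS ≡ map shift₁ (Pin τ) → SameSet (Pin τ) U ⇔ SameSet PS S
  SameSet-shift₁ τ PS refl = relabel-SameSet shift₁ Remove₁.h-injective (λ _ → ⊥) S U (Pin τ) PS
    (λ x → mk⇔ (λ x∈ → inj₁ (∈-map⁻ shift₁ x∈)) [ (λ { (y , y∈ , refl) → ∈-map⁺ shift₁ y∈ }) , ⊥-elim ]′)
    ∈U⇔shift₁∈S (λ _ ()) (λ _ ()) ∈S⇒shift₁

  -- In a permutation with pinnacle set S containing t, t+1 in this order, t+1 is a pinnacle,
  -- hence followed by a letter b, and b < t.
  record UpShape (σ : List ℕ) : Set where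
    field
      pre post : List ℕ
      b : ℕ
      shape : σ ≡ pre ++ t ∷ suc t ∷ b ∷ post
      b<t : b < t
      pre-fresh : ∀ z → z ∈ pre → z ≢ t × z ≢ suc t
      post-fresh : ∀ z → z ∈ b ∷ post → z ≢ t × z ≢ suc t
      before : (pre ≡ [] × prevOf t σ ≡ 0) ⊎ (∃₂ λ pre′ a → pre ≡ pre′ ++ a ∷ [] × prevOf t σ ≡ a)

  upShape : ∀ σ → σ ∈ perms N → WithUp σ ≡ true → UpShape σ
  upShape σ σ∈ withUp = from-adjacency (adjacentᵇ⁻ t (suc t) σ (∧-trueʳ {hasPinᵇ S σ} withUp))
    where
    u : AtMostOnce σ
    u = PermOf⇒AtMostOnce {N} {σ} (perms-sound N σ σ∈)
    t+1∈Pin : suc t ∈ Pin σ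
    t+1∈Pin = from (hasPinᵇ⁻ S σ (∧-trueˡ withUp) (suc t)) t+1∈S
    from-adjacency : (∃₂ λ P Q → σ ≡ P ++ t ∷ suc t ∷ Q) → UpShape σ
    from-adjacency (P , Q , σ≡) with Pin-neighbours σ (P ++ t ∷ []) Q u t+1∈Pin (trans σ≡ (sym (++-assoc P (t ∷ []) (suc t ∷ Q))))
    ... | _ , _ , b , post , _ , refl , _ , b<t+1 = record
      { pre = P ; post = post ; b = b ; shape = σ≡
      ; b<t = ≤∧≢⇒< (≤-pred b<t+1) (λ { refl → t∉Q (there (here refl)) })
      ; pre-fresh = λ z z∈ → (λ { refl → t∉P z∈ }) , (λ { refl → t+1∉P z∈ })
      ; post-fresh = λ z z∈ → (λ { refl → t∉Q (there z∈) }) , (λ { refl → t+1∉Q z∈ })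
      ; before = before (initLast P)
      }
      where
      t-once : t ∉ P × t ∉ suc t ∷ b ∷ post
      t-once = occ≤1⇒∉-around t P (suc t ∷ b ∷ post) (subst (λ l → occ t l ≤ 1) σ≡ (u t))
      t∉P : t ∉ P
      t∉P = proj₁ t-once
      t∉Q : t ∉ suc t ∷ b ∷ post
      t∉Q = proj₂ t-once
      t+1-once : suc t ∉ P ++ t ∷ [] × suc t ∉ b ∷ post
      t+1-once = occ≤1⇒∉-around (suc t) (P ++ t ∷ []) (b ∷ post)
        (subst (λ l → occ (suc t) l ≤ 1) (trans σ≡ (sym (++-assoc P (t ∷ []) (suc t ∷ b ∷ post)))) (u (suc t)))
      t+1∉P : suc t ∉ P
      t+1∉P z∈ = proj₁ t+1-once (∈-++⁺ˡ z∈)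
      t+1∉Q : suc t ∉ b ∷ post
      t+1∉Q = proj₂ t+1-once
      before : InitLast P → (P ≡ [] × prevOf t σ ≡ 0) ⊎ (∃₂ λ pre′ a → P ≡ pre′ ++ a ∷ [] × prevOf t σ ≡ a)
      before [] = inj₁ (refl , trans (cong (prevOf t) σ≡) (prevOf-head t t (suc t ∷ b ∷ post) t∉Q))
      before (pre′ ∷ʳ′ a) = inj₂ (pre′ , a , refl ,
        trans (cong (prevOf t) (trans σ≡ (++-assoc pre′ (a ∷ []) (t ∷ suc t ∷ b ∷ post))))
          (prevOf-once t pre′ a (suc t ∷ b ∷ post) (λ p → t∉P (∈-++⁺ˡ p)) (λ e → t∉P (∈-++⁺ʳ pre′ (here e)))))

  record Correspondence (k : ℕ) (Y : List ℕ) (remove : List ℕ → List ℕ) (σ τ : List ℕ) : Set where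
    field
      perm : PermOf k τ ⇔ PermOf N σ
      pins : SameSet (Pin τ) Y ⇔ SameSet (Pin σ) S
      removed : remove σ ≡ τ

  correspondence-forward : ∀ {k Y remove σ τ} → Correspondence k Y remove σ τ → τ ∈ perms k → hasPinᵇ Y τ ≡ true →
    σ ∈ perms N × hasPinᵇ S σ ≡ true × remove σ ≡ τ
  correspondence-forward {k} {Y} {σ = σ} {τ} c τ∈ τ-pins =
    perms-complete N σ (to perm (perms-sound k τ τ∈)) , hasPinᵇ⁺ S σ (to pins (hasPinᵇ⁻ Y τ τ-pins)) , removed
    where open Correspondence c

  correspondence-backward : ∀ {k Y remove σ τ} → Correspondence k Y remove σ τ → σ ∈ perms N → hasPinᵇ S σ ≡ true →
    τ ∈ perms k × hasPinᵇ Y τ ≡ true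
  correspondence-backward {k} {Y} {σ = σ} {τ} c σ∈ σ-pins =
    perms-complete k τ (from perm (perms-sound N σ σ∈)) , hasPinᵇ⁺ Y τ (from pins (hasPinᵇ⁻ S σ σ-pins))
    where open Correspondence c

  positive : ∀ {k σ x} → σ ∈ perms k → x ∈ σ → (x ≡ᵇ 0) ≡ false
  positive {k} {σ} {x} σ∈ x∈ = ≢⇒≡ᵇ-false {x} {0} (λ { refl → 1+n≰n (proj₁ (PermOf-bounds {k} {σ} (perms-sound k σ σ∈) x∈)) })

  StartsAtT : List ℕ → Bool
  StartsAtT σ = WithUp σ ∧ (prevOf t σ ≡ᵇ 0)

  insertAtStart : List ℕ → List ℕ
  insertAtStart τ = t ∷ suc t ∷ map shift₂ τ

  startsAtT-correspondence : ∀ τ b L → map shift₂ τ ≡ b ∷ L → b < t →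
    Correspondence m V Remove₂.remove (insertAtStart τ) τ
  startsAtT-correspondence τ b L shifted b<t = record
    { perm = mk⇔ (Remove₂.PermOf-insert [] (map shift₂ τ) τ refl) (Remove₂.PermOf-remove [] (map shift₂ τ) τ refl)
    ; pins = SameSet-shift₂ τ (Pin (insertAtStart τ)) λ x →
        mk⇔ (λ x∈ → case-∷ (subst (x ∈_) Pin≡ x∈)) [ (λ q → subst (x ∈_) (sym Pin≡) (there q)) , (λ e → subst (x ∈_) (sym Pin≡) (here e)) ]′
    ; removed = Remove₂.remove-middle [] (map shift₂ τ) τ refl
    }
    where
    Pin≡ : Pin (insertAtStart τ) ≡ suc t ∷ Pin (map shift₂ τ)
    Pin≡ rewrite shifted = Pin-peak t (suc t) b L (n<1+n t) (m<n⇒m<1+n b<t)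
    case-∷ : ∀ {x y L} → x ∈ y ∷ L → x ∈ L ⊎ x ≡ y
    case-∷ (here e) = inj₂ e
    case-∷ (there q) = inj₁ q

  -- The first letter of a permutation with pinnacle set V is no pinnacle, hence smaller than t.
  head<t : ∀ τ → τ ∈ perms m → hasPinᵇ V τ ≡ true → ∃₂ λ b τ′ → τ ≡ b ∷ τ′ × b < t
  head<t [] τ∈ _ with PermOf-∈ {m} {[]} {1} (perms-sound m [] τ∈) (s≤s z≤n) 1≤m
  ... | ()
  head<t (b ∷ τ′) τ∈ pins with b <? t
  ... | yes b<t = b , τ′ , refl , b<t
  ... | no b≮t = ⊥-elim (head∉Pin b τ′ (PermOf⇒AtMostOnce {m} {b ∷ τ′} P) b∈Pin refl)
    where
    P : PermOf m (b ∷ τ′)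
    P = perms-sound m (b ∷ τ′) τ∈
    b∈Pin : b ∈ Pin (b ∷ τ′)
    b∈Pin = from (hasPinᵇ⁻ V (b ∷ τ′) pins b)
      (from (∈-T++range-above t m (≮⇒≥ b≮t)) (≮⇒≥ b≮t , proj₂ (PermOf-bounds {m} {b ∷ τ′} P (here refl))))

  startsAtT-forward : ∀ τ → τ ∈ perms m → hasPinᵇ V τ ≡ true →
    insertAtStart τ ∈ perms N × StartsAtT (insertAtStart τ) ≡ true × Remove₂.remove (insertAtStart τ) ≡ τ
  startsAtT-forward τ τ∈ pins with head<t τ τ∈ pins
  ... | b , τ′ , refl , b<t with correspondence-forward (startsAtT-correspondence τ b _ shifted b<t) τ∈ pins
    where
    shifted : map shift₂ (b ∷ τ′) ≡ b ∷ map shift₂ τ′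
    shifted = cong (_∷ _) (shift₂-< b<t)
  ...   | σ∈ , σ-pins , removed =
    σ∈ , ∧-true⁺ (∧-true⁺ σ-pins (adjacentᵇ⁺ t (suc t) [] (map shift₂ (b ∷ τ′)))) (cong (_≡ᵇ 0) (prevOf-head t t _ t∉)) , removed
    where
    t∉ : t ∉ suc t ∷ map shift₂ (b ∷ τ′)
    t∉ (here e) = 1+n≢n (sym e)
    t∉ (there q) = let (y , _ , e) = ∈-map⁻ shift₂ q in shift₂≢t y (sym e)

  startsAtT-backward : ∀ σ → σ ∈ perms N → StartsAtT σ ≡ true →
    Remove₂.remove σ ∈ perms m × hasPinᵇ V (Remove₂.remove σ) ≡ true × insertAtStart (Remove₂.remove σ) ≡ σ
  startsAtT-backward σ σ∈ starts with upShape σ σ∈ (∧-trueˡ starts)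
  ... | record { shape = refl ; before = inj₂ (pre′ , a , refl , prev≡a) } =
    ⊥-elim (true≢false (trans (sym (subst (λ v → (v ≡ᵇ 0) ≡ true) prev≡a (∧-trueʳ {WithUp σ} starts)))
                              (positive {N} σ∈ (∈-++⁺ˡ (∈-++⁺ʳ pre′ (here refl))))))
  ... | record { post = post ; b = b ; shape = refl ; b<t = b<t ; post-fresh = post-fresh ; before = inj₁ (refl , _) } =
    let (τ∈ , τ-pins) = correspondence-backward corr σ∈ (∧-trueˡ (∧-trueˡ starts))
    in τ∈ , τ-pins , cong (λ l → t ∷ suc t ∷ l) shifted
    where
    τ : List ℕ
    τ = Remove₂.remove (t ∷ suc t ∷ b ∷ post)
    shifted : map shift₂ τ ≡ b ∷ post
    shifted = Remove₂.map-remove-middle [] (b ∷ post) (λ z z∈ → isT∨T+1-false (proj₁ (post-fresh z z∈)) (proj₂ (post-fresh z z∈)))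
    corr : Correspondence m V Remove₂.remove (t ∷ suc t ∷ b ∷ post) τ
    corr = subst (λ l → Correspondence m V Remove₂.remove l τ) (cong (λ l → t ∷ suc t ∷ l) shifted)
             (startsAtT-correspondence τ b post shifted b<t)

  AfterSmall : List ℕ → Bool
  AfterSmall σ = (WithUp σ ∧ not (prevOf t σ ≡ᵇ 0)) ∧ (prevOf t σ <ᵇ t)

  insertT : List ℕ → List ℕ
  insertT τ = insertBefore (suc t) (t ∷ []) (map shift₁ τ)

  afterSmall-correspondence : ∀ τ pre a b post → map shift₁ τ ≡ pre ++ a ∷ suc t ∷ b ∷ post →
    a < t → b < suc t → suc t ∉ pre → suc t ∉ b ∷ post →
    insertT τ ≡ pre ++ a ∷ t ∷ suc t ∷ b ∷ post × Correspondence (suc m) U Remove₁.remove (insertT τ) τ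
  afterSmall-correspondence τ pre a b post shifted a<t b<t+1 t+1∉pre t+1∉post = inserted , record
    { perm = subst (λ l → PermOf (suc m) τ ⇔ PermOf N l) (sym inserted′)
        (mk⇔ (Remove₁.PermOf-insert X Y τ shifted′) (Remove₁.PermOf-remove X Y τ shifted′))
    ; pins = SameSet-shift₁ τ (Pin (insertT τ)) Pin≡
    ; removed = trans (cong Remove₁.remove inserted′) (Remove₁.remove-middle X Y τ shifted′)
    }
    where
    X Y : List ℕ
    X = pre ++ a ∷ []
    Y = suc t ∷ b ∷ post
    shifted′ : map shift₁ τ ≡ X ++ Y
    shifted′ = trans shifted (sym (++-assoc pre (a ∷ []) Y))
    t+1∉X : suc t ∉ X
    t+1∉X q = [ t+1∉pre , (λ { (here e) → <⇒≢ (m<n⇒m<1+n a<t) (sym e) }) ]′ (∈-++⁻ pre q)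
    inserted′ : insertT τ ≡ X ++ (t ∷ []) ++ Y
    inserted′ = trans (cong (insertBefore (suc t) (t ∷ [])) shifted′)
                  (insertBefore-once (suc t) (t ∷ []) X (b ∷ post) t+1∉X t+1∉post)
    inserted : insertT τ ≡ pre ++ a ∷ t ∷ suc t ∷ b ∷ post
    inserted = trans inserted′ (++-assoc pre (a ∷ []) (t ∷ Y))
    Pin≡ : Pin (insertT τ) ≡ map shift₁ (Pin τ)
    Pin≡ = begin
      Pin (insertT τ)                       ≡⟨ cong Pin inserted ⟩
      Pin (pre ++ a ∷ t ∷ suc t ∷ b ∷ post) ≡⟨ Pin-insert-ascent pre a t (suc t) b post a<t (n<1+n t) b<t+1 ⟩
      Pin (pre ++ a ∷ suc t ∷ b ∷ post)     ≡⟨ cong Pin (sym shifted) ⟩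
      Pin (map shift₁ τ)                    ≡⟨ Pin-shift₁ τ ⟩
      map shift₁ (Pin τ)                    ∎
      where open ≡-Reasoning

  afterSmall⁺ : ∀ σ pre a post → σ ≡ pre ++ a ∷ t ∷ suc t ∷ post → σ ∈ perms N → hasPinᵇ S σ ≡ true → t ∉ pre →
    a < t → AfterSmall σ ≡ true
  afterSmall⁺ σ pre a post σ≡ σ∈ pins t∉pre a<t =
    subst (λ v → ((WithUp σ ∧ not (v ≡ᵇ 0)) ∧ (v <ᵇ t)) ≡ true) (sym prev≡a)
      (∧-true⁺ (∧-true⁺ (∧-true⁺ pins up-σ) (not-true⁺ (positive {N} σ∈ a∈σ))) (<⇒<ᵇ-true a<t))
    where
    up-σ : up σ ≡ true
    up-σ = subst (λ l → up l ≡ true) (sym (trans σ≡ (sym (++-assoc pre (a ∷ []) (t ∷ suc t ∷ post)))))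
             (adjacentᵇ⁺ t (suc t) (pre ++ a ∷ []) post)
    prev≡a : prevOf t σ ≡ a
    prev≡a = trans (cong (prevOf t) σ≡) (prevOf-once t pre a (suc t ∷ post) t∉pre (λ { refl → <-irrefl refl a<t }))
    a∈σ : a ∈ σ
    a∈σ = subst (a ∈_) (sym σ≡) (∈-++⁺ʳ pre (here refl))

  afterSmall-forward : ∀ τ → τ ∈ perms (suc m) → hasPinᵇ U τ ≡ true →
    insertT τ ∈ perms N × AfterSmall (insertT τ) ≡ true × Remove₁.remove (insertT τ) ≡ τ
  afterSmall-forward τ τ∈ pins = around-t+1 (∈-Pin⁻ (map shift₁ τ) t+1∈Pin)
    where
    t+1∈Pin : suc t ∈ Pin (map shift₁ τ)
    t+1∈Pin = subst (suc t ∈_) (sym (Pin-shift₁ τ)) (subst (_∈ map shift₁ (Pin τ)) (shift₁-≥ ≤-refl)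
      (∈-map⁺ shift₁ (from (hasPinᵇ⁻ U τ pins t) (from (∈-T++range-above t (suc m) ≤-refl) (≤-refl , t≤1+m)))))
    u : AtMostOnce (map shift₁ τ)
    u = AtMostOnce-map shift₁ unshift₁ unshift₁-shift₁ τ (PermOf⇒AtMostOnce {suc m} {τ} (perms-sound (suc m) τ τ∈))
    t∉image : t ∉ map shift₁ τ
    t∉image q = let (y , _ , e) = ∈-map⁻ shift₁ q in shift₁≢t y (sym e)
    around-t+1 : (∃₂ λ pre a → ∃₂ λ b post → map shift₁ τ ≡ pre ++ a ∷ suc t ∷ b ∷ post × a < suc t × b < suc t) →
      insertT τ ∈ perms N × AfterSmall (insertT τ) ≡ true × Remove₁.remove (insertT τ) ≡ τ
    around-t+1 (pre , a , b , post , shifted , a<t+1 , b<t+1) =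
      let (inserted , corr) = afterSmall-correspondence τ pre a b post shifted a<t b<t+1
                                (λ q → proj₁ t+1-once (∈-++⁺ˡ q)) (proj₂ t+1-once)
          (σ∈ , σ-pins , removed) = correspondence-forward corr τ∈ pins
      in σ∈ , afterSmall⁺ (insertT τ) pre a (b ∷ post) inserted σ∈ σ-pins t∉pre a<t , removed
      where
      a<t : a < t
      a<t = ≤∧≢⇒< (≤-pred a<t+1) (λ { refl → t∉image (subst (t ∈_) (sym shifted) (∈-++⁺ʳ pre (here refl))) })
      t∉pre : t ∉ pre
      t∉pre q = t∉image (subst (t ∈_) (sym shifted) (∈-++⁺ˡ q))
      t+1-once : suc t ∉ pre ++ a ∷ [] × suc t ∉ b ∷ post
      t+1-once = occ≤1⇒∉-around (suc t) (pre ++ a ∷ []) (b ∷ post)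
        (subst (λ l → occ (suc t) l ≤ 1) (trans shifted (sym (++-assoc pre (a ∷ []) (suc t ∷ b ∷ post)))) (u (suc t)))

  afterSmall-backward : ∀ σ → σ ∈ perms N → AfterSmall σ ≡ true →
    Remove₁.remove σ ∈ perms (suc m) × hasPinᵇ U (Remove₁.remove σ) ≡ true × insertT (Remove₁.remove σ) ≡ σ
  afterSmall-backward σ σ∈ small with upShape σ σ∈ (∧-trueˡ (∧-trueˡ small))
  ... | record { shape = refl ; before = inj₁ (refl , prev≡0) } =
    ⊥-elim (true≢false (trans (sym (∧-trueʳ {WithUp σ} (∧-trueˡ small))) (cong (λ v → not (v ≡ᵇ 0)) prev≡0)))
  ... | record { post = post ; b = b ; shape = refl ; b<t = b<t ; pre-fresh = pre-fresh ; post-fresh = post-fresh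
               ; before = inj₂ (pre′ , a , refl , prev≡a) } =
    let (τ∈ , τ-pins) = correspondence-backward corr σ∈ (∧-trueˡ (∧-trueˡ (∧-trueˡ small)))
    in τ∈ , τ-pins , inserted
    where
    X Y : List ℕ
    X = pre′ ++ a ∷ []
    Y = suc t ∷ b ∷ post
    a<t : a < t
    a<t = <ᵇ-true⇒< (subst (λ v → (v <ᵇ t) ≡ true) prev≡a (∧-trueʳ {WithUp σ ∧ not (prevOf t σ ≡ᵇ 0)} small))
    τ : List ℕ
    τ = Remove₁.remove σ
    kept : ∀ z → z ∈ X ++ Y → isT z ≡ false
    kept z z∈ with ∈-++⁻ X z∈
    ... | inj₁ q = ≢⇒≡ᵇ-false (proj₁ (pre-fresh z q))
    ... | inj₂ (here refl) = ≢⇒≡ᵇ-false {suc t} {t} 1+n≢n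
    ... | inj₂ (there q) = ≢⇒≡ᵇ-false (proj₁ (post-fresh z q))
    shifted : map shift₁ τ ≡ pre′ ++ a ∷ Y
    shifted = trans (Remove₁.map-remove-middle X Y kept) (++-assoc pre′ (a ∷ []) Y)
    correspond : insertT τ ≡ pre′ ++ a ∷ t ∷ Y × Correspondence (suc m) U Remove₁.remove (insertT τ) τ
    correspond = afterSmall-correspondence τ pre′ a b post shifted a<t (m<n⇒m<1+n b<t)
                   (λ q → proj₂ (pre-fresh _ (∈-++⁺ˡ q)) refl) (λ q → proj₂ (post-fresh _ q) refl)
    inserted : insertT τ ≡ σ
    inserted = trans (proj₁ correspond) (sym (++-assoc pre′ (a ∷ []) (t ∷ Y)))
    corr : Correspondence (suc m) U Remove₁.remove σ τ
    corr = subst (λ l → Correspondence (suc m) U Remove₁.remove l τ) inserted (proj₂ correspond)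

  AfterLarge : List ℕ → Bool
  AfterLarge σ = (WithUp σ ∧ not (prevOf t σ ≡ᵇ 0)) ∧ not (prevOf t σ <ᵇ t)

  AfterPinnacle : ℕ → List ℕ → Bool
  AfterPinnacle a σ = AfterLarge σ ∧ (prevOf t σ ≡ᵇ a)

  insertAfterPinnacle : ℕ → List ℕ → List ℕ
  insertAfterPinnacle a τ = insertAfter a (t ∷ suc t ∷ []) (map shift₂ τ)

  afterPinnacle-correspondence : ∀ a τ pre c b post → map shift₂ τ ≡ pre ++ c ∷ a ∷ b ∷ post →
    c < a → t < a → b < t → a ∉ pre ++ c ∷ [] → a ∉ b ∷ post →
    insertAfterPinnacle a τ ≡ pre ++ c ∷ a ∷ t ∷ suc t ∷ b ∷ post ×
    Correspondence m V Remove₂.remove (insertAfterPinnacle a τ) τ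
  afterPinnacle-correspondence a τ pre c b post shifted c<a t<a b<t a∉P a∉Y = inserted , record
    { perm = subst (λ l → PermOf m τ ⇔ PermOf N l) (sym inserted′)
        (mk⇔ (Remove₂.PermOf-insert X Y τ shifted′) (Remove₂.PermOf-remove X Y τ shifted′))
    ; pins = SameSet-shift₂ τ (Pin (insertAfterPinnacle a τ)) λ x →
        subst₂ (λ l l′ → x ∈ Pin l ⇔ (x ∈ Pin l′ ⊎ x ≡ suc t)) (sym inserted) (sym shifted)
          (Pin-insert-after-peak pre c a t (suc t) b post c<a t<a (n<1+n t) (m<n⇒m<1+n b<t) (<-trans b<t t<a) x)
    ; removed = trans (cong Remove₂.remove inserted′) (Remove₂.remove-middle X Y τ shifted′)
    }
    where
    P X Y : List ℕ
    P = pre ++ c ∷ []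
    X = P ++ a ∷ []
    Y = b ∷ post
    shifted′ : map shift₂ τ ≡ X ++ Y
    shifted′ = trans shifted (trans (sym (++-assoc pre (c ∷ []) (a ∷ Y))) (sym (++-assoc P (a ∷ []) Y)))
    inserted′ : insertAfterPinnacle a τ ≡ X ++ (t ∷ suc t ∷ []) ++ Y
    inserted′ = trans (cong (insertAfter a (t ∷ suc t ∷ [])) (trans shifted′ (++-assoc P (a ∷ []) Y)))
      (trans (insertAfter-once a (t ∷ suc t ∷ []) P Y a∉P a∉Y) (sym (++-assoc P (a ∷ []) (t ∷ suc t ∷ Y))))
    inserted : insertAfterPinnacle a τ ≡ pre ++ c ∷ a ∷ t ∷ suc t ∷ b ∷ post
    inserted = trans inserted′ (trans (++-assoc P (a ∷ []) (t ∷ suc t ∷ Y)) (++-assoc pre (c ∷ []) (a ∷ t ∷ suc t ∷ Y)))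

  ≥t+2⇒∈S : ∀ {a} → suc (suc t) ≤ a → a ≤ N → a ∈ S
  ≥t+2⇒∈S t+2≤a a≤N = from (∈-T++range _ (suc t) N) (inj₂ (≤-trans (n≤1+n _) t+2≤a , a≤N))

  afterPinnacle⁺ : ∀ a σ pre post → σ ≡ pre ++ a ∷ t ∷ suc t ∷ post → σ ∈ perms N → hasPinᵇ S σ ≡ true → t ∉ pre →
    suc (suc t) ≤ a → AfterPinnacle a σ ≡ true
  afterPinnacle⁺ a σ pre post σ≡ σ∈ pins t∉pre t+2≤a =
    subst (λ v → (((WithUp σ ∧ not (v ≡ᵇ 0)) ∧ not (v <ᵇ t)) ∧ (v ≡ᵇ a)) ≡ true) (sym prev≡a)
      (∧-true⁺ (∧-true⁺ (∧-true⁺ (∧-true⁺ pins up-σ) (not-true⁺ (positive {N} σ∈ a∈σ)))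
                        (not-true⁺ (≮⇒<ᵇ-false (<⇒≱ t<a ∘ <⇒≤))))
               (≡ᵇ-refl a))
    where
    t<a : t < a
    t<a = ≤-trans (n≤1+n _) t+2≤a
    up-σ : up σ ≡ true
    up-σ = subst (λ l → up l ≡ true) (sym (trans σ≡ (sym (++-assoc pre (a ∷ []) (t ∷ suc t ∷ post)))))
             (adjacentᵇ⁺ t (suc t) (pre ++ a ∷ []) post)
    prev≡a : prevOf t σ ≡ a
    prev≡a = trans (cong (prevOf t) σ≡) (prevOf-once t pre a (suc t ∷ post) t∉pre (<⇒≢ t<a))
    a∈σ : a ∈ σ
    a∈σ = subst (a ∈_) (sym σ≡) (∈-++⁺ʳ pre (here refl))

  shift₂-Pin : ∀ τ → hasPinᵇ V τ ≡ true → ∀ {y} → y ∈ V → shift₂ y ∈ Pin (map shift₂ τ)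
  shift₂-Pin τ pins {y} y∈V = subst (shift₂ y ∈_) (sym (Pin-shift₂ τ)) (∈-map⁺ shift₂ (from (hasPinᵇ⁻ V τ pins y) y∈V))

  -- Otherwise b, as a relabelled letter ≥ t, would itself be a pinnacle.
  right-of-pinnacle<t : ∀ τ → τ ∈ perms m → hasPinᵇ V τ ≡ true → ∀ pre a b post →
    map shift₂ τ ≡ pre ++ a ∷ b ∷ post → b < a → b < t
  right-of-pinnacle<t τ τ∈ pins pre a b post shifted b<a
    with ∈-map⁻ shift₂ (subst (b ∈_) (sym shifted) (∈-++⁺ʳ pre (there (here refl))))
  ... | y , y∈ , refl with y <? t
  ...   | yes y<t = subst (_< t) (sym (shift₂-< y<t)) y<t
  ...   | no y≮t
    with Pin-neighbours (map shift₂ τ) (pre ++ a ∷ []) post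
           (AtMostOnce-map shift₂ unshift₂ unshift₂-shift₂ τ (PermOf⇒AtMostOnce {m} {τ} (perms-sound m τ τ∈)))
           (shift₂-Pin τ pins (from (∈-T++range-above t m (≮⇒≥ y≮t))
              (≮⇒≥ y≮t , proj₂ (PermOf-bounds {m} {τ} (perms-sound m τ τ∈) y∈))))
           (trans shifted (sym (++-assoc pre (a ∷ []) (shift₂ y ∷ post))))
  ...     | _ , a′ , _ , _ , pre≡ , _ , a′<b , _ =
    ⊥-elim (<-asym b<a (subst (_< shift₂ y) (sym (proj₂ (∷ʳ-injective pre _ pre≡))) a′<b))

  afterPinnacle-forward : ∀ a → suc (suc t) ≤ a → a ≤ N → ∀ τ → τ ∈ perms m → hasPinᵇ V τ ≡ true →
    insertAfterPinnacle a τ ∈ perms N × AfterPinnacle a (insertAfterPinnacle a τ) ≡ true ×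
    Remove₂.remove (insertAfterPinnacle a τ) ≡ τ
  afterPinnacle-forward a t+2≤a a≤N τ τ∈ pins = around-a (∈-Pin⁻ (map shift₂ τ) a∈Pin)
    where
    a∈Pin : a ∈ Pin (map shift₂ τ)
    a∈Pin = subst (_∈ Pin (map shift₂ τ)) a≡ (shift₂-Pin τ pins (from (∈V⇔shift₂∈S (unshift₂ a))
              (subst (_∈ S) (sym a≡) (≥t+2⇒∈S t+2≤a a≤N))))
      where
      a≡ : shift₂ (unshift₂ a) ≡ a
      a≡ = shift₂-unshift₂ a (<⇒≢ (≤-trans (n≤1+n _) t+2≤a) ∘ sym) (<⇒≢ t+2≤a ∘ sym)
    u : AtMostOnce (map shift₂ τ)
    u = AtMostOnce-map shift₂ unshift₂ unshift₂-shift₂ τ (PermOf⇒AtMostOnce {m} {τ} (perms-sound m τ τ∈))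
    around-a : (∃₂ λ pre c → ∃₂ λ b post → map shift₂ τ ≡ pre ++ c ∷ a ∷ b ∷ post × c < a × b < a) →
      insertAfterPinnacle a τ ∈ perms N × AfterPinnacle a (insertAfterPinnacle a τ) ≡ true ×
      Remove₂.remove (insertAfterPinnacle a τ) ≡ τ
    around-a (pre , c , b , post , shifted , c<a , b<a) =
      let (inserted , corr) = afterPinnacle-correspondence a τ pre c b post shifted c<a (≤-trans (n≤1+n _) t+2≤a) b<t
                                (proj₁ a-once) (proj₂ a-once)
          (σ∈ , σ-pins , removed) = correspondence-forward corr τ∈ pins
      in σ∈ , afterPinnacle⁺ a (insertAfterPinnacle a τ) (pre ++ c ∷ []) (b ∷ post)
                (trans inserted (sym (++-assoc pre (c ∷ []) (a ∷ t ∷ suc t ∷ b ∷ post)))) σ∈ σ-pins t∉P t+2≤a ,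
         removed
      where
      shifted′ : map shift₂ τ ≡ (pre ++ c ∷ []) ++ a ∷ b ∷ post
      shifted′ = trans shifted (sym (++-assoc pre (c ∷ []) (a ∷ b ∷ post)))
      b<t : b < t
      b<t = right-of-pinnacle<t τ τ∈ pins (pre ++ c ∷ []) a b post shifted′ b<a
      t∉P : t ∉ pre ++ c ∷ []
      t∉P q = let (y , _ , e) = ∈-map⁻ shift₂ (subst (t ∈_) (sym shifted′) (∈-++⁺ˡ q)) in shift₂≢t y (sym e)
      a-once : a ∉ pre ++ c ∷ [] × a ∉ b ∷ post
      a-once = occ≤1⇒∉-around a (pre ++ c ∷ []) (b ∷ post) (subst (λ l → occ a l ≤ 1) shifted′ (u a))

  afterPinnacle-backward : ∀ a → suc (suc t) ≤ a → a ≤ N → ∀ σ → σ ∈ perms N → AfterPinnacle a σ ≡ true →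
    Remove₂.remove σ ∈ perms m × hasPinᵇ V (Remove₂.remove σ) ≡ true × insertAfterPinnacle a (Remove₂.remove σ) ≡ σ
  afterPinnacle-backward a t+2≤a a≤N σ σ∈ after with upShape σ σ∈ withUp
    where
    withUp : WithUp σ ≡ true
    withUp = ∧-trueˡ (∧-trueˡ (∧-trueˡ after))
  ... | record { shape = refl ; before = inj₁ (refl , prev≡0) } =
    ⊥-elim (true≢false (trans (sym (∧-trueʳ {WithUp σ} (∧-trueˡ (∧-trueˡ after)))) (cong (λ v → not (v ≡ᵇ 0)) prev≡0)))
  ... | record { post = post ; b = b ; shape = refl ; b<t = b<t ; pre-fresh = pre-fresh ; post-fresh = post-fresh
               ; before = inj₂ (pre′ , a′ , refl , prev≡a′) }
    with trans (sym prev≡a′) (≡ᵇ-true⇒≡ (∧-trueʳ {AfterLarge σ} after))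
  ...   | refl with Pin-neighbours σ pre′ (t ∷ suc t ∷ b ∷ post) u a∈Pin (++-assoc pre′ (a ∷ []) (t ∷ suc t ∷ b ∷ post))
    where
    u : AtMostOnce σ
    u = PermOf⇒AtMostOnce {N} {σ} (perms-sound N σ σ∈)
    a∈Pin : a ∈ Pin σ
    a∈Pin = from (hasPinᵇ⁻ S σ (∧-trueˡ (∧-trueˡ (∧-trueˡ (∧-trueˡ after)))) a) (≥t+2⇒∈S t+2≤a a≤N)
  ...     | pre , c , _ , _ , refl , _ , c<a , _ =
    let (τ∈ , τ-pins) = correspondence-backward corr σ∈ (∧-trueˡ (∧-trueˡ (∧-trueˡ (∧-trueˡ after))))
    in τ∈ , τ-pins , inserted
    where
    X Y : List ℕ
    X = (pre ++ c ∷ []) ++ a ∷ []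
    Y = b ∷ post
    u : AtMostOnce σ
    u = PermOf⇒AtMostOnce {N} {σ} (perms-sound N σ σ∈)
    τ : List ℕ
    τ = Remove₂.remove σ
    kept : ∀ z → z ∈ X ++ Y → isT∨T+1 z ≡ false
    kept z z∈ = let (z≢t , z≢t+1) = [ pre-fresh z , post-fresh z ]′ (∈-++⁻ X z∈) in isT∨T+1-false z≢t z≢t+1
    shifted : map shift₂ τ ≡ pre ++ c ∷ a ∷ b ∷ post
    shifted = trans (Remove₂.map-remove-middle X Y kept)
                (trans (++-assoc (pre ++ c ∷ []) (a ∷ []) Y) (++-assoc pre (c ∷ []) (a ∷ Y)))
    a-once : a ∉ pre ++ c ∷ [] × a ∉ t ∷ suc t ∷ b ∷ post
    a-once = occ≤1⇒∉-around a (pre ++ c ∷ []) (t ∷ suc t ∷ b ∷ post)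
      (subst (λ l → occ a l ≤ 1) (++-assoc (pre ++ c ∷ []) (a ∷ []) (t ∷ suc t ∷ b ∷ post)) (u a))
    correspond : insertAfterPinnacle a τ ≡ pre ++ c ∷ a ∷ t ∷ suc t ∷ Y × Correspondence m V Remove₂.remove (insertAfterPinnacle a τ) τ
    correspond = afterPinnacle-correspondence a τ pre c b post shifted c<a (≤-trans (n≤1+n _) t+2≤a) b<t
                   (proj₁ a-once) (λ q → proj₂ a-once (there (there q)))
    inserted : insertAfterPinnacle a τ ≡ σ
    inserted = trans (proj₁ correspond)
      (sym (trans (++-assoc (pre ++ c ∷ []) (a ∷ []) (t ∷ suc t ∷ Y)) (++-assoc pre (c ∷ []) (a ∷ t ∷ suc t ∷ Y))))
    corr : Correspondence m V Remove₂.remove σ τ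
    corr = subst (λ l → Correspondence m V Remove₂.remove l τ) inserted (proj₂ correspond)

  AfterLarge⇒prevOf∈range : ∀ σ → σ ∈ perms N → AfterLarge σ ≡ true → prevOf t σ ∈ range (suc (suc t)) N
  AfterLarge⇒prevOf∈range σ σ∈ large with upShape σ σ∈ (∧-trueˡ (∧-trueˡ large))
  ... | record { shape = refl ; before = inj₁ (refl , prev≡0) } =
    ⊥-elim (true≢false (trans (sym (∧-trueʳ {WithUp σ} (∧-trueˡ large))) (cong (λ v → not (v ≡ᵇ 0)) prev≡0)))
  ... | record { post = post ; b = b ; shape = refl ; pre-fresh = pre-fresh
               ; before = inj₂ (pre′ , a , refl , prev≡a) } =
    subst (_∈ range (suc (suc t)) N) (sym prev≡a) (∈-range⁺ (suc (suc t)) N t+2≤a a≤N)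
    where
    a∈pre : a ∈ pre′ ++ a ∷ []
    a∈pre = ∈-++⁺ʳ pre′ (here refl)
    a≤N : a ≤ N
    a≤N = proj₂ (PermOf-bounds {N} {σ} (perms-sound N σ σ∈) (∈-++⁺ˡ a∈pre))
    a≮t : ¬ a < t
    a≮t a<t = true≢false (trans (sym (<⇒<ᵇ-true a<t))
      (trans (cong (_<ᵇ t) (sym prev≡a)) (not-true⁻ (∧-trueʳ {WithUp σ ∧ not (prevOf t σ ≡ᵇ 0)} large))))
    t+2≤a : suc (suc t) ≤ a
    t+2≤a = ≥t∧≢⇒≥t+2 (≮⇒≥ a≮t) (proj₁ (pre-fresh a a∈pre)) (proj₂ (pre-fresh a a∈pre))

  cV cU : ℕ
  cV = count (hasPinᵇ V) (perms m)
  cU = count (hasPinᵇ U) (perms (suc m))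

  count-StartsAtT : count StartsAtT (perms N) ≡ cV
  count-StartsAtT = sym (count-bijection (hasPinᵇ V) StartsAtT insertAtStart Remove₂.remove (perms m) (perms N)
    (perms-distinct m) (perms-distinct N) startsAtT-forward startsAtT-backward)

  count-AfterSmall : count AfterSmall (perms N) ≡ cU
  count-AfterSmall = sym (count-bijection (hasPinᵇ U) AfterSmall insertT Remove₁.remove (perms (suc m)) (perms N)
    (perms-distinct (suc m)) (perms-distinct N) afterSmall-forward afterSmall-backward)

  count-AfterLarge : count AfterLarge (perms N) ≡ (suc m ∸ t) * cV
  count-AfterLarge = begin
    count AfterLarge (perms N)
      ≡⟨ count-by-key AfterLarge (prevOf t) (perms N) (range (suc (suc t)) N) cV
           (AtMostOnce⇒Distinct (range (suc (suc t)) N) (range-AtMostOnce (suc (suc t)) N))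
           AfterLarge⇒prevOf∈range per-pinnacle ⟩
    length (range (suc (suc t)) N) * cV
      ≡⟨ cong (_* cV) (length-range (suc (suc t)) N) ⟩
    (suc m ∸ t) * cV ∎
    where
    open ≡-Reasoning
    per-pinnacle : ∀ a → a ∈ range (suc (suc t)) N → count (AfterPinnacle a) (perms N) ≡ cV
    per-pinnacle a a∈ = let (t+2≤a , a≤N) = ∈-range⁻ (suc (suc t)) N a∈ in
      sym (count-bijection (hasPinᵇ V) (AfterPinnacle a) (insertAfterPinnacle a) Remove₂.remove (perms m) (perms N)
        (perms-distinct m) (perms-distinct N) (afterPinnacle-forward a t+2≤a a≤N) (afterPinnacle-backward a t+2≤a a≤N))

  count-WithUp : count WithUp (perms N) ≡ cU + (N ∸ t) * cV
  count-WithUp = begin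
    count WithUp (perms N)
      ≡⟨ count-split WithUp (λ σ → prevOf t σ ≡ᵇ 0) (perms N) ⟩
    count StartsAtT (perms N) + count (λ σ → WithUp σ ∧ not (prevOf t σ ≡ᵇ 0)) (perms N)
      ≡⟨ cong (count StartsAtT (perms N) +_) (count-split _ (λ σ → prevOf t σ <ᵇ t) (perms N)) ⟩
    count StartsAtT (perms N) + (count AfterSmall (perms N) + count AfterLarge (perms N))
      ≡⟨ cong₂ (λ x y → x + (count AfterSmall (perms N) + y)) count-StartsAtT count-AfterLarge ⟩
    cV + (count AfterSmall (perms N) + (suc m ∸ t) * cV)
      ≡⟨ cong (λ x → cV + (x + (suc m ∸ t) * cV)) count-AfterSmall ⟩
    cV + (cU + (suc m ∸ t) * cV)
      ≡⟨ rearrange cV cU (suc m ∸ t) ⟩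
    cU + suc (suc m ∸ t) * cV
      ≡⟨ cong (λ k → cU + k * cV) (sym (+-∸-assoc 1 t≤1+m)) ⟩
    cU + (N ∸ t) * cV ∎
    where
    open ≡-Reasoning
    rearrange : ∀ v u k → v + (u + k * v) ≡ u + suc k * v
    rearrange = solve-∀

  recurrence : count (hasPinᵇ S) (perms N) ≡
    count (hasPinᵇ S′) (perms N) + 2 * cU + 2 * (N ∸ t) * cV
  recurrence = begin
    count (hasPinᵇ S) (perms N)
      ≡⟨ count-S-by-adjacency ⟩
    count WithUp (perms N) + (count WithDown (perms N) + count Apart (perms N))
      ≡⟨ cong₂ (λ x y → count WithUp (perms N) + (x + y)) count-WithDown count-Apart ⟩
    count WithUp (perms N) + (count WithUp (perms N) + count (hasPinᵇ S′) (perms N))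
      ≡⟨ cong (λ x → x + (x + count (hasPinᵇ S′) (perms N))) count-WithUp ⟩
    (cU + (N ∸ t) * cV) + ((cU + (N ∸ t) * cV) + count (hasPinᵇ S′) (perms N))
      ≡⟨ rearrange cU ((N ∸ t) * cV) (count (hasPinᵇ S′) (perms N)) ⟩
    count (hasPinᵇ S′) (perms N) + 2 * cU + 2 * ((N ∸ t) * cV)
      ≡⟨ cong (count (hasPinᵇ S′) (perms N) + 2 * cU +_) (sym (*-assoc 2 (N ∸ t) cV)) ⟩
    count (hasPinᵇ S′) (perms N) + 2 * cU + 2 * (N ∸ t) * cV ∎
    where
    open ≡-Reasoning
    rearrange : ∀ u w s → (u + w) + ((u + w) + s) ≡ s + 2 * u + 2 * w
    rearrange = solve-∀

mainTheorem1 : (T : List ℕ) (t n : ℕ) → t < n → All (_< t) T →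
    IsPinnacleSet (T ++ range (suc t) n) →
    p n (T ++ range (suc t) n)
      ≡ p n (T ++ (t ∷ range (t + 2) n))
        + 2 * p (n ∸ 1) (T ++ range t (n ∸ 1))
        + 2 * (n ∸ t) * p (n ∸ 2) (T ++ range t (n ∸ 2))
mainTheorem1 T t n t<n T<t (k , σ , σ↭ , pins) = recurrence-at n t<n (pinnacle≥3 (∈-range⁺ (suc t) n t<n ≤-refl))
  where
  pinnacle≥3 : ∀ {x} → x ∈ range (suc t) n → 3 ≤ x
  pinnacle≥3 x∈ = Pin≥3 k σ _ (↭⇒PermOf σ↭) (from (pins _) (∈-++⁺ʳ T x∈))
  1≤t : 1 ≤ t
  1≤t = ≤-trans (s≤s z≤n) (≤-pred (pinnacle≥3 (∈-range⁺ (suc t) n ≤-refl t<n)))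
  recurrence-at : ∀ n → t < n → 3 ≤ n →
    p n (T ++ range (suc t) n)
      ≡ p n (T ++ (t ∷ range (t + 2) n)) + 2 * p (n ∸ 1) (T ++ range t (n ∸ 1))
        + 2 * (n ∸ t) * p (n ∸ 2) (T ++ range t (n ∸ 2))
  recurrence-at (suc zero) _ (s≤s ())
  recurrence-at (suc (suc zero)) _ (s≤s (s≤s ()))
  recurrence-at (suc (suc (suc m))) t<n _
    rewrite p≡count (suc (suc (suc m))) (T ++ range (suc t) (suc (suc (suc m))))
          | p≡count (suc (suc (suc m))) (T ++ t ∷ range (t + 2) (suc (suc (suc m))))
          | p≡count (suc (suc m)) (T ++ range t (suc (suc m)))
          | p≡count (suc m) (T ++ range t (suc m))
    = Recurrence.recurrence T t (suc m) T<t 1≤t (≤-pred t<n) (s≤s z≤n)
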